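{- Let $n\ge2$ be even, $p\in[0,1]$, and $0\le i\le n-1$ an integer. Then $$\psi_{[n-i,1^i]}=\frac{1}{\binom{n-1}{i}}\sum_{j}\left[\binom{n/2-1}{j,\ \frac{i-j}{2},\ \frac{n-i-j-2}{2}}(2p)^j(2p-1)^{\frac{i-j}{2}}+\binom{n/2-1}{j,\ \frac{i-j-1}{2},\ \frac{n-i-j-1}{2}}(2p)^j(2p-1)^{\frac{i-j-1}{2}+1}\right],$$ where the sum is over integers $j\ge0$, and a multinomial coefficient is taken to be $0$ unless all its lower entries are nonnegative integers.
   Context: For a partition $\lambda$ of $n$, let $\chi_\lambda$ be the irreducible character of $S_n$ indexed by $\lambda$, $d_\lambda=\chi_\lambda(\mathrm{id})$, and $(1^{n-2s},2^s)$ the conjugacy class of involutions with exactly $s$ two-cycles. Define $$\psi_\lambda=\sum_{s=0}^{n/2}p^{n/2-s}(1-p)^s\binom{n/2}{s}\frac{\chi_\lambda(1^{n-2s},2^s)}{d_\lambda}.$$ $[n-i,1^i]$ is the hook partition with first row $n-i$ and $i$ further rows of length $1$. $\binom{N}{a,b,c}=\frac{N!}{a!\,b!\,c!}$ when $a+b+c=N$ with $a,b,c$ nonnegative integers.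
   Formalization: The parameter p ranges over the rationals in $[0,1]$. -}

module Defs where

open import Data.Bool.Base using (Bool; true; false; if_then_else_; _∧_; not)
open import Data.Nat.Base as ℕ using (ℕ; zero; suc; _∸_; _≤ᵇ_; _<ᵇ_; _≡ᵇ_; _!)
open import Data.Nat.Combinatorics.Base using (_C_)
open import Data.Integer.Base as ℤ using (ℤ; +_; -[1+_])
open import Data.Rational.Base as ℚ using (ℚ; 0ℚ; 1ℚ; _÷_; ≢-nonZero)
open import Data.Rational.Properties using (_≟_)
open import Data.List.Base using (List; []; _∷_; _++_; [_]; map; foldr; length; filterᵇ; replicate; upTo)
open import Data.Bool.ListAction using (any)
open import Data.Product.Base using (_×_; _,_)
open import Data.Maybe.Base using (Maybe; just; nothing)
open import Relation.Nullary using (yes; no)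

sumℤ : List ℤ → ℤ
sumℤ = foldr ℤ._+_ (+ 0)

sumℚ : List ℚ → ℚ
sumℚ = foldr ℚ._+_ 0ℚ

sumUpTo : ℕ → (ℕ → ℚ) → ℚ
sumUpTo N f = sumℚ (map f (upTo (suc N)))

_^ℚ_ : ℚ → ℕ → ℚ
x ^ℚ zero  = 1ℚ
x ^ℚ suc k = x ℚ.* (x ^ℚ k)

-- Division of rationals (only ever applied to a nonzero divisor below;
-- returns 0 on division by zero).
_÷ℚ_ : ℚ → ℚ → ℚ
x ÷ℚ y with y ≟ 0ℚ
... | yes _  = 0ℚ
... | no y≢0 = _÷_ x y {{≢-nonZero y≢0}}

ℕ→ℚ : ℕ → ℚ
ℕ→ℚ k = ℚ._/_ (+ k) 1

ℤ→ℚ : ℤ → ℚ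
ℤ→ℚ z = ℚ._/_ z 1

-- Characters of S_n via the Murnaghan–Nakayama rule (on beta-sets).
-- A partition λ = (λ₁ ≥ … ≥ λ_ℓ) is a list of its parts; a conjugacy
-- class of S_n is given by the list of its cycle lengths (all ≥ 1).  Removing a rim hook of
-- length k corresponds to replacing some b in the beta-set by b - k,
-- where b - k ≥ 0 is not in the set; its sign is (-1)^(leg length)
-- = (-1)^#{c in set : b - k < c < b}.

betaSet : List ℕ → List ℕ
betaSet []       = []
betaSet (x ∷ xs) = (x ℕ.+ length xs) ∷ betaSet xs

memberᵇ : ℕ → List ℕ → Bool
memberᵇ x xs = any (λ c → c ≡ᵇ x) xs

signℤ : ℕ → ℤ
signℤ m = (-[1+ 0 ]) ℤ.^ m

rimHookRemovals : ℕ → List ℕ → List (List ℕ × ℤ)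
rimHookRemovals k β = go [] β
  where
  go : List ℕ → List ℕ → List (List ℕ × ℤ)
  go pre []         = []
  go pre (b ∷ post) =
    (if (k ≤ᵇ b) ∧ not (memberᵇ (b ∸ k) β)
       then [ (pre ++ ((b ∸ k) ∷ post)
              , signℤ (length (filterᵇ (λ c → ((b ∸ k) <ᵇ c) ∧ (c <ᵇ b)) β))) ]
       else [])
    ++ go (pre ++ [ b ]) post

mnβ : List ℕ → List ℕ → ℤ
mnβ β []       = + 1
mnβ β (k ∷ ks) = sumℤ (map (λ { (β′ , ε) → ε ℤ.* mnβ β′ ks }) (rimHookRemovals k β))

χ : List ℕ → List ℕ → ℤ
χ λ′ μ = mnβ (betaSet λ′) μ

idClass : ℕ → List ℕ
idClass n = replicate n 1

dim : ℕ → List ℕ → ℤ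
dim n λ′ = χ λ′ (idClass n)

invClass : ℕ → ℕ → List ℕ
invClass n s = replicate s 2 ++ replicate (n ∸ 2 ℕ.* s) 1

hook : ℕ → ℕ → List ℕ
hook n i = (n ∸ i) ∷ replicate i 1

ψ : ℕ → List ℕ → ℚ → ℚ
ψ n λ′ p = sumUpTo m (λ s →
      (p ^ℚ (m ∸ s)) ℚ.* ((1ℚ ℚ.- p) ^ℚ s) ℚ.* ℕ→ℚ (m C s)
      ℚ.* (ℤ→ℚ (χ λ′ (invClass n s)) ÷ℚ ℤ→ℚ (dim n λ′)))
  where
  m = n ℕ./ 2

toℕ? : ℚ → Maybe ℕ
toℕ? q with ℚ.denominatorℕ q ≡ᵇ 1 | ℚ.numerator q
... | true | + k = just k
... | _    | _   = nothing

multinomial : ℕ → ℚ → ℚ → ℚ → ℚ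
multinomial N a b c with toℕ? a | toℕ? b | toℕ? c
... | just a′ | just b′ | just c′ =
      if (a′ ℕ.+ b′ ℕ.+ c′) ≡ᵇ N
        then ℕ→ℚ (N !) ÷ℚ ℕ→ℚ ((a′ !) ℕ.* (b′ !) ℕ.* (c′ !))
        else 0ℚ
... | _ | _ | _ = 0ℚ

ℕ/2 : ℕ → ℚ
ℕ/2 x = ℚ._/_ (+ x) 2

ℤ/2 : ℤ → ℚ
ℤ/2 x = ℚ._/_ x 2

{-# OPTIONS --safe #-}
module Submission where

open import Defs
open import Data.Nat.Base as ℕ using (ℕ; _∸_; _<_; _≤_)
open import Data.Nat.Divisibility using (_∣_)
open import Data.Nat.Combinatorics.Base using (_C_)
open import Data.Integer.Base as ℤ using (+_)
open import Data.Rational.Base as ℚ using (ℚ; 0ℚ; 1ℚ)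
open import Relation.Binary.PropositionalEquality using (_≡_)

-- On the beta-set {1, …, i} ∪ {n} of the hook (n − i, 1 ^ i) the Murnaghan–Nakayama rule only ever
-- moves the top bead down or a bead into the gap, which gives
-- χ (2 ^ s 1 ^ (n − 2 s)) = [x ^ i] (1 − x) ^ s (1 + x) ^ (n − s − 1) and d = C (n − 1, i).
-- With m = n / 2 the binomial theorem for p (1 + x) + (1 − p) (1 − x) = 1 + (2 p − 1) x turns the sum
-- defining ψ into C (n − 1, i) ψ = [x ^ i] (1 + (2 p − 1) x) ((1 + x) (1 + (2 p − 1) x)) ^ (m − 1),
-- and the trinomial expansion of (1 + x) (1 + (2 p − 1) x) = 1 + 2 p x + (2 p − 1) x² gives the two sums.

module HookCharacters where

  open import Data.Bool.Base using (Bool; true; false; if_then_else_; _∧_; not; T)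
  open import Data.Bool.Properties using (∧-zeroʳ; T-∧; ¬-not)
  open import Data.Integer.Base as ℤ using (ℤ; +_; -[1+_])
  import Data.Integer.Properties as ℤ
  open import Data.Integer.Solver using (module +-*-Solver)
  open import Data.List.Base using (List; []; _∷_; [_]; _++_; map; length; filterᵇ; replicate)
  open import Data.List.Properties
    using (++-assoc; length-++; length-replicate; filter-++; filter-accept; filter-reject; filter-none; filter-≐)
  open import Data.List.Membership.Propositional using (_∈_)
  open import Data.List.Relation.Unary.Any using (here; there)
  open import Data.List.Relation.Unary.All as All using (All; []; _∷_; tabulate; lookup; universal)
  open import Data.Nat.Base
  open import Data.Nat.Properties
  open import Data.Nat.Combinatorics using (_C_; nCk+nC[k+1]≡[n+1]C[k+1]; k>n⇒nCk≡0)
  open import Algebra.Properties.CommutativeSemigroup +-commutativeSemigroup using (x∙yz≈y∙xz)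
  open import Data.Product.Base using (_×_; _,_; proj₁; proj₂)
  open import Data.Sum.Base using (_⊎_; inj₁; inj₂)
  open import Function.Base using (_∘_)
  open import Function.Bundles using (Equivalence)
  open import Relation.Nullary.Decidable using (T?; yes; no; dec-true; dec-false)
  open import Relation.Nullary.Negation using (¬_; contradiction)
  open import Relation.Binary.PropositionalEquality hiding ([_])

  count : ℕ → List ℕ → ℕ
  count x L = length (filterᵇ (_≡ᵇ x) L)

  count-here : ∀ x L → count x (x ∷ L) ≡ suc (count x L)
  count-here x L = cong length (filter-accept (T? ∘ (_≡ᵇ x)) {x} {L} (≡⇒≡ᵇ x x refl))

  count-there : ∀ {x c} L → c ≢ x → count x (c ∷ L) ≡ count x L
  count-there {x} {c} L c≢x = cong length (filter-reject (T? ∘ (_≡ᵇ x)) {c} {L} (c≢x ∘ ≡ᵇ⇒≡ c x))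

  count-++ : ∀ x A B → count x (A ++ B) ≡ count x A + count x B
  count-++ x A B = trans (cong length (filter-++ (T? ∘ (_≡ᵇ x)) A B)) (length-++ (filterᵇ (_≡ᵇ x) A))

  count-middle : ∀ x A y B → count x (A ++ y ∷ B) ≡ count x (y ∷ A ++ B)
  count-middle x A y B = begin
    count x (A ++ y ∷ B)              ≡⟨ count-++ x A (y ∷ B) ⟩
    count x A + count x (y ∷ B)       ≡⟨ cong (_+_ (count x A)) (count-++ x [ y ] B) ⟩
    count x A + (count x [ y ] + count x B) ≡⟨ x∙yz≈y∙xz (count x A) (count x [ y ]) (count x B) ⟩
    count x [ y ] + (count x A + count x B) ≡⟨ cong (_+_ (count x [ y ])) (count-++ x A B) ⟨
    count x [ y ] + count x (A ++ B)  ≡⟨ count-++ x [ y ] (A ++ B) ⟨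
    count x (y ∷ A ++ B)              ∎
    where open ≡-Reasoning

  ∈⇒count≢0 : ∀ {x L} → x ∈ L → count x L ≢ 0
  ∈⇒count≢0 {x} {_ ∷ L} (here refl) = subst (_≢ 0) (sym (count-here x L)) (λ ())
  ∈⇒count≢0 {x} {c ∷ L} (there x∈L) with c ≡ᵇ x
  ... | true  = λ ()
  ... | false = ∈⇒count≢0 x∈L

  memberᵇ≡0<ᵇcount : ∀ x L → memberᵇ x L ≡ (0 <ᵇ count x L)
  memberᵇ≡0<ᵇcount x [] = refl
  memberᵇ≡0<ᵇcount x (c ∷ L) with c ≡ᵇ x
  ... | true  = refl
  ... | false = memberᵇ≡0<ᵇcount x L

  -- The local function go of rimHookRemovals has no name outside Defs: with-abstracting the arguments
  -- of one of its calls lets unification solve the meta removalsFrom as go itself, so that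
  -- removalsFrom k β pre post unfolds by go's clauses.
  mutual
    removalsFrom : ℕ → List ℕ → List ℕ → List ℕ → List (List ℕ × ℤ)
    removalsFrom = _

    private
      removalsFrom-solution : ∀ k β → rimHookRemovals (suc k) (0 ∷ β) ≡ rimHookRemovals (suc k) (0 ∷ β)
      removalsFrom-solution k β with suc k | 0 ∷ β | [ 0 ]
      ... | k′ | β′ | pre = trans {j = removalsFrom k′ β′ pre β} refl refl

  removable : ℕ → List ℕ → ℕ → Bool
  removable k β b = (k ≤ᵇ b) ∧ not (memberᵇ (b ∸ k) β)

  legSign : ℕ → List ℕ → ℕ → ℤ
  legSign k β b = signℤ (length (filterᵇ (λ c → ((b ∸ k) <ᵇ c) ∧ (c <ᵇ b)) β))

  removalTerm : List ℕ → List ℕ × ℤ → ℤ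
  removalTerm ks (β , ε) = ε ℤ.* mnβ β ks

  sumℤ-map-++ : ∀ {A : Set} (f : A → ℤ) xs ys → sumℤ (map f (xs ++ ys)) ≡ sumℤ (map f xs) ℤ.+ sumℤ (map f ys)
  sumℤ-map-++ f [] ys = sym (ℤ.+-identityˡ _)
  sumℤ-map-++ f (x ∷ xs) ys = trans (cong (ℤ._+_ (f x)) (sumℤ-map-++ f xs ys)) (sym (ℤ.+-assoc (f x) _ _))

  removalsFrom-none : ∀ k β pre post → All (λ b → removable k β b ≡ false) post → removalsFrom k β pre post ≡ []
  removalsFrom-none k β pre [] [] = refl
  removalsFrom-none k β pre (b ∷ post) (¬r ∷ ¬rs) rewrite ¬r = removalsFrom-none k β (pre ++ [ b ]) post ¬rs

  sum-removalsFrom-unique : ∀ k β ks pre post c (v : ℤ) →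
    All (λ b → removable k β b ≡ true → b ≡ c) post → count c post ≡ 1 → removable k β c ≡ true →
    (∀ A B → A ++ c ∷ B ≡ post → legSign k β c ℤ.* mnβ (pre ++ A ++ (c ∸ k) ∷ B) ks ≡ v) →
    sumℤ (map (removalTerm ks) (removalsFrom k β pre post)) ≡ v
  sum-removalsFrom-unique k β ks pre [] c v [] () c-rem value
  sum-removalsFrom-unique k β ks pre (b ∷ post) c v (only ∷ onlys) once c-rem value with removable k β b in b-rem
  ... | true with refl ← only refl =
    trans (cong (ℤ._+_ (removalTerm ks (pre ++ (b ∸ k) ∷ post , legSign k β b))) rest≡0)
          (trans (ℤ.+-identityʳ _) (value [] post refl))
    where
    absent : count b post ≡ 0
    absent = suc-injective (trans (sym (count-here b post)) once)
    others : All (λ x → removable k β x ≡ false) post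
    others = tabulate λ x∈post → ¬-not λ x-rem →
      ∈⇒count≢0 (subst (_∈ post) (lookup onlys x∈post x-rem) x∈post) absent
    rest≡0 : sumℤ (map (removalTerm ks) (removalsFrom k β (pre ++ [ b ]) post)) ≡ + 0
    rest≡0 = cong (sumℤ ∘ map (removalTerm ks)) (removalsFrom-none k β (pre ++ [ b ]) post others)
  ... | false = sum-removalsFrom-unique k β ks (pre ++ [ b ]) post c v onlys once′ c-rem value′
    where
    b≢c : b ≢ c
    b≢c refl = contradiction (trans (sym b-rem) c-rem) (λ ())
    once′ : count c post ≡ 1
    once′ = trans (sym (count-there post b≢c)) once
    value′ : ∀ A B → A ++ c ∷ B ≡ post → legSign k β c ℤ.* mnβ ((pre ++ [ b ]) ++ A ++ (c ∸ k) ∷ B) ks ≡ v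
    value′ A B eq rewrite ++-assoc pre [ b ] (A ++ (c ∸ k) ∷ B) = value (b ∷ A) B (cong (b ∷_) eq)

  removable-yes : ∀ {k β b} → k ≤ b → memberᵇ (b ∸ k) β ≡ false → removable k β b ≡ true
  removable-yes k≤b free rewrite dec-true (_ ≤? _) k≤b | free = refl

  removable-occupied : ∀ {k β b} → memberᵇ (b ∸ k) β ≡ true → removable k β b ≡ false
  removable-occupied {k} {β} {b} occupied rewrite occupied = ∧-zeroʳ (k ≤ᵇ b)

  removable-short : ∀ {k β b} → b < k → removable k β b ≡ false
  removable-short b<k rewrite dec-false (_ ≤? _) (<⇒≱ b<k) = refl

  legSign-empty : ∀ {k β b} → All (λ c → ¬ (b ∸ k < c × c < b)) β → legSign k β b ≡ + 1
  legSign-empty {k} {β} {b} none = cong (signℤ ∘ length) (filter-none (T? ∘ between) (All.map outside none))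
    where
    between : ℕ → Bool
    between c = ((b ∸ k) <ᵇ c) ∧ (c <ᵇ b)
    outside : ∀ {c} → ¬ (b ∸ k < c × c < b) → ¬ T (between c)
    outside ¬btw btw = ¬btw (<ᵇ⇒< _ _ (proj₁ both) , <ᵇ⇒< _ _ (proj₂ both))
      where both = Equivalence.to T-∧ btw

  legSign-1 : ∀ {β b} → legSign 1 β b ≡ + 1
  legSign-1 {β} {b} = legSign-empty {1} {β} {b} (universal (λ c (lo , hi) → <⇒≱ lo (<⇒≤pred hi)) β)

  strictlyBetween-2 : ∀ b c → ((b <ᵇ c) ∧ (c <ᵇ suc (suc b))) ≡ (c ≡ᵇ suc b)
  strictlyBetween-2 zero    zero          = refl
  strictlyBetween-2 zero    (suc zero)    = refl
  strictlyBetween-2 zero    (suc (suc c)) = refl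
  strictlyBetween-2 (suc b) zero          = refl
  strictlyBetween-2 (suc b) (suc c)       = strictlyBetween-2 b c

  legSign-2 : ∀ β b → legSign 2 β (suc (suc b)) ≡ signℤ (count (suc b) β)
  legSign-2 β b = cong (signℤ ∘ length)
    (filter-≐ (T? ∘ between) (T? ∘ (_≡ᵇ suc b)) ((λ {c} → to {c}) , (λ {c} → from {c})) β)
    where
    between : ℕ → Bool
    between c = (b <ᵇ c) ∧ (c <ᵇ suc (suc b))
    to : ∀ {c} → T (between c) → T (c ≡ᵇ suc b)
    to {c} = subst T (strictlyBetween-2 b c)
    from : ∀ {c} → T (c ≡ᵇ suc b) → T (between c)
    from {c} = subst T (sym (strictlyBetween-2 b c))

  -- t ∷ L is a beta-set of the hook (t ∸ i , 1 ^ (i ∸ g)) padded with g zero parts: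
  -- L holds each of 0, …, i except g exactly once.
  record IsHookBeta (i t g : ℕ) (L : List ℕ) : Set where
    field
      g≤i      : g ≤ i
      i<t      : i < t
      count-≤i : ∀ {x} → x ≤ i → x ≢ g → count x L ≡ 1
      count->i : ∀ {x} → i < x → count x L ≡ 0
      count-g  : count g L ≡ 0

  IsHookBeta-raise : ∀ {i t g L t′} → i < t′ → IsHookBeta i t g L → IsHookBeta i t′ g L
  IsHookBeta-raise i<t′ h = record { IsHookBeta h ; i<t = i<t′ }

  IsHookBeta-extend : ∀ {i t g L} → suc i < t → IsHookBeta i t g L → IsHookBeta (suc i) t g (suc i ∷ L)
  IsHookBeta-extend {i} {t} {g} {L} i+1<t h = record
    { g≤i = m≤n⇒m≤1+n g≤i ; i<t = i+1<t ; count-≤i = count-≤i′ ; count->i = count->i′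
    ; count-g = trans (count-there L (>⇒≢ (s≤s g≤i))) count-g }
    where
    open IsHookBeta h
    count-≤i′ : ∀ {x} → x ≤ suc i → x ≢ g → count x (suc i ∷ L) ≡ 1
    count-≤i′ {x} x≤i+1 x≢g with x ≟ suc i
    ... | yes refl = trans (count-here x L) (cong suc (count->i ≤-refl))
    ... | no x≢i+1 = trans (count-there L (x≢i+1 ∘ sym)) (count-≤i (m<1+n⇒m≤n (≤∧≢⇒< x≤i+1 x≢i+1)) x≢g)
    count->i′ : ∀ {x} → suc i < x → count x (suc i ∷ L) ≡ 0
    count->i′ i+1<x = trans (count-there L (<⇒≢ i+1<x)) (count->i (<-trans (n<1+n i) i+1<x))

  IsHookBeta-hook : ∀ i {t} → i < t → IsHookBeta i t 0 (betaSet (replicate i 1))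
  IsHookBeta-hook zero 0<t = record
    { g≤i = z≤n ; i<t = 0<t ; count-≤i = λ { z≤n 0≢0 → contradiction refl 0≢0 }
    ; count->i = λ _ → refl ; count-g = refl }
  IsHookBeta-hook (suc i) i+1<t =
    subst (λ h → IsHookBeta (suc i) _ 0 (suc h ∷ betaSet (replicate i 1))) (sym (length-replicate i))
          (IsHookBeta-extend i+1<t (IsHookBeta-hook i (<-trans (n<1+n i) i+1<t)))

  count-insert-≡ : ∀ x A B → count x (A ++ x ∷ B) ≡ suc (count x (A ++ B))
  count-insert-≡ x A B = trans (count-middle x A x B) (count-here x (A ++ B))

  count-insert-≢ : ∀ {x y} A B → y ≢ x → count x (A ++ y ∷ B) ≡ count x (A ++ B)
  count-insert-≢ {x} {y} A B y≢x = trans (count-middle x A y B) (count-there (A ++ B) y≢x)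

  IsHookBeta-move : ∀ {i t g k} A B → 1 ≤ k → g + k ≤ i →
    IsHookBeta i t g (A ++ (g + k) ∷ B) → IsHookBeta i t (g + k) (A ++ g ∷ B)
  IsHookBeta-move {i} {t} {g} {k} A B 1≤k g+k≤i h = record
    { g≤i = g+k≤i ; i<t = i<t ; count-≤i = count-≤i′ ; count->i = count->i′ ; count-g = count-g′ }
    where
    open IsHookBeta h
    g<g+k : g < g + k
    g<g+k = m<m+n g 1≤k
    unmoved : ∀ {x} → x ≢ g + k → count x (A ++ B) ≡ count x (A ++ (g + k) ∷ B)
    unmoved x≢g+k = sym (count-insert-≢ A B (x≢g+k ∘ sym))
    count-≤i′ : ∀ {x} → x ≤ i → x ≢ g + k → count x (A ++ g ∷ B) ≡ 1
    count-≤i′ {x} x≤i x≢g+k with x ≟ g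
    ... | yes refl = trans (count-insert-≡ x A B) (cong suc (trans (unmoved x≢g+k) count-g))
    ... | no x≢g = trans (count-insert-≢ A B (x≢g ∘ sym)) (trans (unmoved x≢g+k) (count-≤i x≤i x≢g))
    count->i′ : ∀ {x} → i < x → count x (A ++ g ∷ B) ≡ 0
    count->i′ i<x = trans (count-insert-≢ A B (<⇒≢ (≤-<-trans g≤i i<x)))
      (trans (unmoved (>⇒≢ (≤-<-trans g+k≤i i<x))) (count->i i<x))
    count-g′ : count (g + k) (A ++ g ∷ B) ≡ 0
    count-g′ = trans (count-insert-≢ A B (<⇒≢ g<g+k))
      (suc-injective (trans (sym (count-insert-≡ (g + k) A B)) (count-≤i g+k≤i (>⇒≢ g<g+k))))

  headTerm : ℕ → ℕ → List ℕ → List ℕ → ℤ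
  headTerm k t L ks = sumℤ (map (removalTerm ks)
    (if removable k (t ∷ L) t then [ ((t ∸ k) ∷ L , legSign k (t ∷ L) t) ] else []))

  gapTerm : ℕ → ℕ → List ℕ → List ℕ → ℤ
  gapTerm k t L ks = sumℤ (map (removalTerm ks) (removalsFrom k (t ∷ L) [ t ] L))

  mnβ-split : ∀ k t L ks → mnβ (t ∷ L) (k ∷ ks) ≡ headTerm k t L ks ℤ.+ gapTerm k t L ks
  mnβ-split k t L ks = sumℤ-map-++ (removalTerm ks)
    (if removable k (t ∷ L) t then [ ((t ∸ k) ∷ L , legSign k (t ∷ L) t) ] else [])
    (removalsFrom k (t ∷ L) [ t ] L)

  module _ {i t g L} (h : IsHookBeta i t g L) where
    open IsHookBeta h

    ∈⇒≤i : ∀ {x} → x ∈ L → x ≤ i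
    ∈⇒≤i {x} x∈L with x ≤? i
    ... | yes x≤i = x≤i
    ... | no x≰i = contradiction (count->i (≰⇒> x≰i)) (∈⇒count≢0 x∈L)

    count-∷ : ∀ {x} → x ≢ t → count x (t ∷ L) ≡ count x L
    count-∷ x≢t = count-there L (x≢t ∘ sym)

    memberᵇ-occupied : ∀ {x} → x ≤ i → x ≢ g → memberᵇ x (t ∷ L) ≡ true
    memberᵇ-occupied x≤i x≢g = trans (memberᵇ≡0<ᵇcount _ (t ∷ L))
      (cong (0 <ᵇ_) (trans (count-∷ (<⇒≢ (≤-<-trans x≤i i<t))) (count-≤i x≤i x≢g)))

    memberᵇ-free : ∀ {x} → x ≢ t → i < x ⊎ x ≡ g → memberᵇ x (t ∷ L) ≡ false
    memberᵇ-free x≢t free = trans (memberᵇ≡0<ᵇcount _ (t ∷ L)) (cong (0 <ᵇ_) (trans (count-∷ x≢t) (absent free)))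
      where
      absent : _ → count _ L ≡ 0
      absent (inj₁ i<x) = count->i i<x
      absent (inj₂ refl) = count-g

    removable-∈⇒gap : ∀ {k x} → x ∈ L → removable k (t ∷ L) x ≡ true → x ≡ g + k
    removable-∈⇒gap {k} {x} x∈L rem with k ≤? x
    ... | no k≰x = contradiction (trans (sym rem) (removable-short {k} {t ∷ L} {x} (≰⇒> k≰x))) (λ ())
    ... | yes k≤x with x ∸ k ≟ g
    ...   | yes x∸k≡g = trans (sym (m∸n+n≡m k≤x)) (cong (_+ k) x∸k≡g)
    ...   | no x∸k≢g = contradiction (trans (sym rem) (removable-occupied {k} {t ∷ L} {x} occupied)) (λ ())
      where occupied = memberᵇ-occupied (≤-trans (m∸n≤m x k) (∈⇒≤i x∈L)) x∸k≢g

    removable-gap : ∀ k → removable k (t ∷ L) (g + k) ≡ true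
    removable-gap k = removable-yes {k} {t ∷ L} {g + k} (m≤n+m k g)
      (subst (λ y → memberᵇ y (t ∷ L) ≡ false) (sym (m+n∸n≡m g k)) (memberᵇ-free (<⇒≢ (≤-<-trans g≤i i<t)) (inj₂ refl)))

    headTerm-free : ∀ {k} ks → 1 ≤ k → k ≤ t → i < t ∸ k ⊎ t ∸ k ≡ g →
      headTerm k t L ks ≡ legSign k (t ∷ L) t ℤ.* mnβ ((t ∸ k) ∷ L) ks
    headTerm-free {k} ks 1≤k k≤t free
      rewrite removable-yes {k} {t ∷ L} {t} k≤t (memberᵇ-free (<⇒≢ (∸-monoʳ-< 1≤k k≤t)) free) = ℤ.+-identityʳ _

    headTerm-blocked : ∀ {k} ks → t ∸ k ≤ i → t ∸ k ≢ g → headTerm k t L ks ≡ + 0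
    headTerm-blocked {k} ks ≤i ≢g rewrite removable-occupied {k} {t ∷ L} {t} (memberᵇ-occupied ≤i ≢g) = refl

    gapTerm-none : ∀ {k} ks → i < g + k → gapTerm k t L ks ≡ + 0
    gapTerm-none {k} ks i<g+k = cong (sumℤ ∘ map (removalTerm ks)) (removalsFrom-none k (t ∷ L) [ t ] L
      (tabulate λ x∈L → ¬-not λ rem → <⇒≱ i<g+k (subst (_≤ i) (removable-∈⇒gap x∈L rem) (∈⇒≤i x∈L))))

    gapTerm-move : ∀ {k} ks (v : ℤ) → 1 ≤ k → g + k ≤ i →
      (∀ {L′} → IsHookBeta i t (g + k) L′ → mnβ (t ∷ L′) ks ≡ v) →
      gapTerm k t L ks ≡ legSign k (t ∷ L) (g + k) ℤ.* v
    gapTerm-move {k} ks v 1≤k g+k≤i value = sum-removalsFrom-unique k (t ∷ L) ks [ t ] L (g + k) _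
      (tabulate removable-∈⇒gap) (count-≤i g+k≤i (>⇒≢ (m<m+n g 1≤k))) (removable-gap k) moved
      where
      moved : ∀ A B → A ++ (g + k) ∷ B ≡ L →
        legSign k (t ∷ L) (g + k) ℤ.* mnβ ([ t ] ++ A ++ (g + k ∸ k) ∷ B) ks ≡ legSign k (t ∷ L) (g + k) ℤ.* v
      moved A B A++B≡L = cong (legSign k (t ∷ L) (g + k) ℤ.*_)
        (trans (cong (λ y → mnβ (t ∷ A ++ y ∷ B) ks) (m+n∸n≡m g k))
               (value (IsHookBeta-move A B 1≤k g+k≤i (subst (IsHookBeta i t g) (sym A++B≡L) h))))

    legSign-head : ∀ {k} → i < t ∸ k → legSign k (t ∷ L) t ≡ + 1
    legSign-head {k} i<t∸k = legSign-empty {k} {t ∷ L} {t} ((λ (_ , t<t) → <-irrefl refl t<t)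
      ∷ tabulate λ c∈L (t∸k<c , _) → <-asym t∸k<c (≤-<-trans (∈⇒≤i c∈L) i<t∸k))

    legSign-2-gap : g + 2 ≤ t → legSign 2 (t ∷ L) (g + 2) ≡ signℤ (count (g + 1) L)
    legSign-2-gap g+2≤t rewrite +-suc g 1 | +-suc g 0 | +-identityʳ g =
      trans (legSign-2 (t ∷ L) g) (cong signℤ (count-∷ (<⇒≢ g+2≤t)))

  shift : ℕ → (ℕ → ℤ) → ℕ → ℤ
  shift zero    F d       = F d
  shift (suc k) F zero    = + 0
  shift (suc k) F (suc d) = shift k F d

  shift-≥ : ∀ k (F : ℕ → ℤ) {d} → k ≤ d → shift k F d ≡ F (d ∸ k)
  shift-≥ zero    F k≤d       = refl
  shift-≥ (suc k) F (s≤s k≤d) = shift-≥ k F k≤d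

  shift-< : ∀ k (F : ℕ → ℤ) {d} → d < k → shift k F d ≡ + 0
  shift-< (suc k) F {zero}  _         = refl
  shift-< (suc k) F {suc d} (s≤s d<k) = shift-< k F d<k

  -- mixedBinomial s e d is the coefficient of x ^ d in (1 - x) ^ s * (1 + x) ^ e.
  mixedBinomial : ℕ → ℕ → ℕ → ℤ
  mixedBinomial zero    e d = + (e C d)
  mixedBinomial (suc s) e d = mixedBinomial s e d ℤ.- shift 1 (mixedBinomial s e) d

  module _ where
    open +-*-Solver

    mixedBinomial-pascal : ∀ s e d → mixedBinomial s (suc e) d ≡ mixedBinomial s e d ℤ.+ shift 1 (mixedBinomial s e) d
    mixedBinomial-pascal zero e zero = refl
    mixedBinomial-pascal zero e (suc d) = cong +_ (trans (sym (nCk+nC[k+1]≡[n+1]C[k+1] e d)) (+-comm (e C d) _))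
    mixedBinomial-pascal (suc s) e zero rewrite mixedBinomial-pascal s e zero =
      solve 1 (λ x → (x :+ con (+ 0)) :- con (+ 0) := (x :- con (+ 0)) :+ con (+ 0)) refl (mixedBinomial s e 0)
    mixedBinomial-pascal (suc s) e (suc d) rewrite mixedBinomial-pascal s e (suc d) | mixedBinomial-pascal s e d =
      solve 3 (λ x y z → (x :+ y) :- (y :+ z) := (x :- y) :+ (y :- z)) refl
        (mixedBinomial s e (suc d)) (mixedBinomial s e d) (shift 1 (mixedBinomial s e) d)

    mixedBinomial-[1-x²] : ∀ s e d →
      mixedBinomial (suc s) (suc e) d ≡ mixedBinomial s e d ℤ.- shift 2 (mixedBinomial s e) d
    mixedBinomial-[1-x²] s e zero rewrite mixedBinomial-pascal s e zero = ℤ.+-identityʳ _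
    mixedBinomial-[1-x²] s e (suc d) rewrite mixedBinomial-pascal s e (suc d) | mixedBinomial-pascal s e d =
      solve 3 (λ x y z → (x :+ y) :- (y :+ z) := x :- z) refl
        (mixedBinomial s e (suc d)) (mixedBinomial s e d) (shift 1 (mixedBinomial s e) d)

  mixedBinomial-vanish : ∀ s e {d} → s + e < d → mixedBinomial s e d ≡ + 0
  mixedBinomial-vanish zero    e         e<d       = cong +_ (k>n⇒nCk≡0 e<d)
  mixedBinomial-vanish (suc s) e {suc d} (s≤s s+e<d)
    rewrite mixedBinomial-vanish s e (m<n⇒m<1+n s+e<d) | mixedBinomial-vanish s e s+e<d = refl

  hookBeta-single : ∀ {i t g L k} → IsHookBeta i t g L → 1 ≤ k → t ≡ g + k →
    mnβ (t ∷ L) [ k ] ≡ legSign k (t ∷ L) t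
  hookBeta-single {i} {t} {g} {L} {k} h 1≤k t≡g+k = begin
    mnβ (t ∷ L) [ k ]                      ≡⟨ mnβ-split k t L [] ⟩
    headTerm k t L [] ℤ.+ gapTerm k t L [] ≡⟨ cong₂ ℤ._+_ (headTerm-free h {k} [] 1≤k k≤t (inj₂ t∸k≡g))
                                                         (gapTerm-none h {k} [] (subst (i <_) t≡g+k (IsHookBeta.i<t h))) ⟩
    legSign k (t ∷ L) t ℤ.* + 1 ℤ.+ + 0   ≡⟨ trans (ℤ.+-identityʳ _) (ℤ.*-identityʳ _) ⟩
    legSign k (t ∷ L) t                    ∎
    where
    open ≡-Reasoning
    k≤t : k ≤ t
    k≤t = subst (k ≤_) (sym t≡g+k) (m≤n+m k g)
    t∸k≡g : t ∸ k ≡ g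
    t∸k≡g = trans (cong (_∸ k) t≡g+k) (m+n∸n≡m g k)

  EvaluatesOnHooks : ℕ → List ℕ → (ℕ → ℤ) → Set
  EvaluatesOnHooks M ks F = ∀ {i t g L} → IsHookBeta i t g L → t ≡ g + M → mnβ (t ∷ L) ks ≡ F (i ∸ g)

  -- A k-hook comes off either by lowering the top bead t to t ∸ k (sign + 1, nothing lies in between)
  -- or by moving the bead g + k into the gap g (sign σ); both leave a hook beta-set with t ∸ g = M.
  hookBeta-step : ∀ {k M ks} (F : ℕ → ℤ) (σ : ℤ) → 1 ≤ k → 1 ≤ M → (∀ {d} → M ≤ d → F d ≡ + 0) →
    EvaluatesOnHooks M ks F →
    ∀ {i t g L} → IsHookBeta i t g L → t ≡ g + (k + M) → (g + k ≤ i → legSign k (t ∷ L) (g + k) ≡ σ) →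
    mnβ (t ∷ L) (k ∷ ks) ≡ F (i ∸ g) ℤ.+ σ ℤ.* shift k F (i ∸ g)
  hookBeta-step {k} {M} {ks} F σ 1≤k 1≤M vanish eval {i} {t} {g} {L} h t≡ gapSign =
    trans (mnβ-split k t L ks) (cong₂ ℤ._+_ head gap)
    where
    open ≡-Reasoning
    open IsHookBeta h
    k≤t : k ≤ t
    k≤t = subst (k ≤_) (sym t≡) (≤-trans (m≤m+n k M) (m≤n+m (k + M) g))
    t∸k≡g+M : t ∸ k ≡ g + M
    t∸k≡g+M = trans (cong (_∸ k) (trans t≡ (x∙yz≈y∙xz g k M))) (m+n∸m≡n k (g + M))
    head : headTerm k t L ks ≡ F (i ∸ g)
    head with i <? t ∸ k
    ... | yes i<t∸k = begin
      headTerm k t L ks                            ≡⟨ headTerm-free h {k} ks 1≤k k≤t (inj₁ i<t∸k) ⟩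
      legSign k (t ∷ L) t ℤ.* mnβ ((t ∸ k) ∷ L) ks ≡⟨ cong₂ ℤ._*_ (legSign-head h {k} i<t∸k)
                                                       (eval (IsHookBeta-raise i<t∸k h) t∸k≡g+M) ⟩
      + 1 ℤ.* F (i ∸ g)                            ≡⟨ ℤ.*-identityˡ _ ⟩
      F (i ∸ g)                                    ∎
    ... | no i≮t∸k = trans (headTerm-blocked h {k} ks t∸k≤i (>⇒≢ (subst (g <_) (sym t∸k≡g+M) (m<m+n g 1≤M))))
                           (sym (vanish (m+n≤o⇒m≤o∸n M (subst (_≤ i) (trans t∸k≡g+M (+-comm g M)) t∸k≤i))))
      where
      t∸k≤i : t ∸ k ≤ i
      t∸k≤i = ≮⇒≥ i≮t∸k
    gap : gapTerm k t L ks ≡ σ ℤ.* shift k F (i ∸ g)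
    gap with g + k ≤? i
    ... | yes g+k≤i = begin
      gapTerm k t L ks                              ≡⟨ gapTerm-move h {k} ks (F (i ∸ (g + k))) 1≤k g+k≤i
                                                         (λ h′ → eval h′ (trans t≡ (sym (+-assoc g k M)))) ⟩
      legSign k (t ∷ L) (g + k) ℤ.* F (i ∸ (g + k)) ≡⟨ cong₂ ℤ._*_ (gapSign g+k≤i) (cong F (sym (∸-+-assoc i g k))) ⟩
      σ ℤ.* F (i ∸ g ∸ k)                           ≡⟨ cong (σ ℤ.*_) (shift-≥ k F k≤i∸g) ⟨
      σ ℤ.* shift k F (i ∸ g)                       ∎
      where
      k≤i∸g : k ≤ i ∸ g
      k≤i∸g = m+n≤o⇒m≤o∸n k (subst (_≤ i) (+-comm g k) g+k≤i)
    ... | no g+k≰i = trans (gapTerm-none h {k} ks (≰⇒> g+k≰i))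
                           (sym (trans (cong (σ ℤ.*_) (shift-< k F i∸g<k)) (ℤ.*-zeroʳ σ)))
      where
      i∸g<k : i ∸ g < k
      i∸g<k = ≰⇒> λ k≤i∸g → g+k≰i (≤-trans (+-monoʳ-≤ g k≤i∸g) (≤-reflexive (m+[n∸m]≡n g≤i)))

  χ-step-1 : ∀ {r ks} → EvaluatesOnHooks (suc r) ks (mixedBinomial 0 r) →
    EvaluatesOnHooks (2 + r) (1 ∷ ks) (mixedBinomial 0 (suc r))
  χ-step-1 {r} {ks} eval {i} {t} {g} {L} h t≡ =
    trans (hookBeta-step {1} {suc r} {ks} (mixedBinomial 0 r) (+ 1) ≤-refl (s≤s z≤n)
            (mixedBinomial-vanish 0 r) eval h t≡ (λ _ → legSign-1 {t ∷ L} {g + 1}))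
          (trans (cong (ℤ._+_ (mixedBinomial 0 r (i ∸ g))) (ℤ.*-identityˡ (shift 1 (mixedBinomial 0 r) (i ∸ g))))
                 (sym (mixedBinomial-pascal 0 r (i ∸ g))))

  χ-step-2 : ∀ {s e M ks} → s + e < M → 1 ≤ M →
    EvaluatesOnHooks M ks (mixedBinomial s e) → EvaluatesOnHooks (2 + M) (2 ∷ ks) (mixedBinomial (suc s) (suc e))
  χ-step-2 {s} {e} {M} {ks} s+e<M 1≤M eval {i} {t} {g} {L} h t≡ =
    trans (hookBeta-step {2} {M} {ks} (mixedBinomial s e) (-[1+ 0 ]) (s≤s z≤n) 1≤M
            (λ M≤d → mixedBinomial-vanish s e (<-≤-trans s+e<M M≤d)) eval h t≡ gapSign)
          (trans (cong (ℤ._+_ (mixedBinomial s e (i ∸ g))) (ℤ.-1*i≡-i _))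
                 (sym (mixedBinomial-[1-x²] s e (i ∸ g))))
    where
    open IsHookBeta h
    gapSign : g + 2 ≤ i → legSign 2 (t ∷ L) (g + 2) ≡ -[1+ 0 ]
    gapSign g+2≤i = trans (legSign-2-gap h (<⇒≤ (≤-<-trans g+2≤i i<t)))
      (cong signℤ (count-≤i (≤-trans (+-monoʳ-≤ g (n≤1+n 1)) g+2≤i) (>⇒≢ (m<m+n g ≤-refl))))

  χ-hookBeta : ∀ s r → EvaluatesOnHooks (s + s + r) (replicate s 2 ++ replicate r 1) (mixedBinomial s (s + r ∸ 1))
  χ-hookBeta zero zero h t≡g+0 =
    contradiction (trans t≡g+0 (+-identityʳ _)) (>⇒≢ (≤-<-trans (IsHookBeta.g≤i h) (IsHookBeta.i<t h)))
  χ-hookBeta zero (suc zero) {i} {t} {g} {L} h t≡g+1 = begin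
    mnβ (t ∷ L) [ 1 ]        ≡⟨ hookBeta-single h ≤-refl t≡g+1 ⟩
    legSign 1 (t ∷ L) t      ≡⟨ legSign-1 {t ∷ L} {t} ⟩
    + 1                      ≡⟨ cong (mixedBinomial 0 0) i∸g≡0 ⟨
    mixedBinomial 0 0 (i ∸ g) ∎
    where
    open ≡-Reasoning
    i∸g≡0 : i ∸ g ≡ 0
    i∸g≡0 = m≤n⇒m∸n≡0 (m<1+n⇒m≤n (subst (i <_) (trans t≡g+1 (+-comm g 1)) (IsHookBeta.i<t h)))
  χ-hookBeta zero (suc (suc r)) = χ-step-1 {r} {replicate (suc r) 1} (χ-hookBeta zero (suc r))
  χ-hookBeta (suc zero) zero {i} {t} {g} {L} h t≡g+2 = begin
    mnβ (t ∷ L) [ 2 ]         ≡⟨ hookBeta-single h (s≤s z≤n) t≡g+2 ⟩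
    legSign 2 (t ∷ L) t       ≡⟨ cong (legSign 2 (t ∷ L)) t≡g+2 ⟩
    legSign 2 (t ∷ L) (g + 2) ≡⟨ legSign-2-gap h (≤-reflexive (sym t≡g+2)) ⟩
    signℤ (count (g + 1) L)   ≡⟨ lastColumn ⟩
    mixedBinomial 1 0 (i ∸ g) ∎
    where
    open ≡-Reasoning
    open IsHookBeta h
    i≤g+1 : i ≤ g + 1
    i≤g+1 = m<1+n⇒m≤n (subst (i <_) (trans t≡g+2 (+-suc g 1)) i<t)
    lastColumn : signℤ (count (g + 1) L) ≡ mixedBinomial 1 0 (i ∸ g)
    lastColumn with g + 1 ≤? i
    ... | yes g+1≤i = trans (cong signℤ (count-≤i g+1≤i (>⇒≢ (m<m+n g ≤-refl))))
      (cong (mixedBinomial 1 0) (sym (trans (cong (_∸ g) (≤-antisym i≤g+1 g+1≤i)) (m+n∸m≡n g 1))))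
    ... | no g+1≰i = trans (cong signℤ (count->i (≰⇒> g+1≰i)))
      (cong (mixedBinomial 1 0) (sym (m≤n⇒m∸n≡0 (m<1+n⇒m≤n (subst (i <_) (+-comm g 1) (≰⇒> g+1≰i))))))
  χ-hookBeta (suc zero) (suc r) =
    χ-step-2 {0} {r} {suc r} {replicate (suc r) 1} ≤-refl (s≤s z≤n) (χ-hookBeta zero (suc r))
  χ-hookBeta (suc (suc s)) r =
    subst (λ M → EvaluatesOnHooks M (replicate (suc (suc s)) 2 ++ replicate r 1) (mixedBinomial (suc (suc s)) (suc (s + r))))
          (cong (λ x → suc (suc (x + r))) (sym (+-suc s (suc s))))
          (χ-step-2 {suc s} {s + r} {suc s + suc s + r} {replicate (suc s) 2 ++ replicate r 1}
                    (≤-reflexive (cong suc size)) (s≤s z≤n) (χ-hookBeta (suc s) r))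
    where
    size : suc (s + (s + r)) ≡ s + suc s + r
    size = trans (cong suc (sym (+-assoc s s r))) (cong (_+ r) (sym (+-suc s s)))

  hook-top : ∀ {n i} → i ≤ n → n ∸ i + length (replicate i 1) ≡ n
  hook-top {n} {i} i≤n = trans (cong (_+_ (n ∸ i)) (length-replicate i)) (m∸n+n≡m i≤n)

  IsHookBeta-hook-of : ∀ {n i} → i < n → IsHookBeta i (n ∸ i + length (replicate i 1)) 0 (betaSet (replicate i 1))
  IsHookBeta-hook-of {n} {i} i<n = IsHookBeta-hook i (subst (i <_) (sym (hook-top (<⇒≤ i<n))) i<n)

  χ-hook-invClass : ∀ {n i s} → i < n → s + s ≤ n →
    χ (hook n i) (invClass n s) ≡ mixedBinomial s (s + (n ∸ 2 * s) ∸ 1) i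
  χ-hook-invClass {n} {i} {s} i<n 2s≤n =
    χ-hookBeta s (n ∸ 2 * s) (IsHookBeta-hook-of i<n) (trans (hook-top (<⇒≤ i<n)) (sym size))
    where
    size : s + s + (n ∸ 2 * s) ≡ n
    size = trans (cong (λ x → s + s + (n ∸ x)) (cong (_+_ s) (+-identityʳ s))) (m+[n∸m]≡n 2s≤n)

  dim-hook : ∀ {n i} → i < n → dim n (hook n i) ≡ + ((n ∸ 1) C i)
  dim-hook i<n = χ-hookBeta 0 _ (IsHookBeta-hook-of i<n) (hook-top (<⇒≤ i<n))

module CoefficientSequences where

  open HookCharacters using (mixedBinomial; shift)
  open import Data.Nat.Base as ℕ using (ℕ; zero; suc; _∸_; _≤_; _<_; z≤n; s≤s)
  import Data.Nat.Properties as ℕ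
  open import Data.Nat.Combinatorics using (_C_; nCk+nC[k+1]≡[n+1]C[k+1]; k>n⇒nCk≡0)
  open import Data.Nat.Coprimality using (1-coprimeTo) renaming (sym to coprime-sym)
  open import Data.Integer.Base as ℤ using (ℤ; +_; -[1+_])
  import Data.Integer.Properties as ℤ
  open import Data.Rational.Base as ℚ using (ℚ; mkℚ; 0ℚ; 1ℚ; _+_; _*_; _-_; -_)
  import Data.Rational.Properties as ℚ
  open import Data.Rational.Solver using (module +-*-Solver)
  open import Data.List.Base using (map; applyUpTo)
  open import Data.Maybe.Base as Maybe using (Maybe; just; nothing)
  open import Function.Base using (_∘_; id)
  open import Relation.Binary.PropositionalEquality
  open import Relation.Nullary.Decidable using (yes; no)

  integral : ℤ → ℚ
  integral z = mkℚ z 0 (coprime-sym (1-coprimeTo ℤ.∣ z ∣))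

  ℤ→ℚ≡mkℚ : ∀ z → ℤ→ℚ z ≡ integral z
  ℤ→ℚ≡mkℚ (+ n)    = ℚ.normalize-coprime (coprime-sym (1-coprimeTo n))
  ℤ→ℚ≡mkℚ -[1+ n ] = cong -_ (ℚ.normalize-coprime (coprime-sym (1-coprimeTo (suc n))))

  ℤ→ℚ-+ : ∀ a b → ℤ→ℚ (a ℤ.+ b) ≡ ℤ→ℚ a + ℤ→ℚ b
  ℤ→ℚ-+ a b rewrite ℤ→ℚ≡mkℚ a | ℤ→ℚ≡mkℚ b =
    cong ℤ→ℚ (sym (cong₂ ℤ._+_ (ℤ.*-identityʳ a) (ℤ.*-identityʳ b)))

  ℤ→ℚ-* : ∀ a b → ℤ→ℚ (a ℤ.* b) ≡ ℤ→ℚ a * ℤ→ℚ b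
  ℤ→ℚ-* a b rewrite ℤ→ℚ≡mkℚ a | ℤ→ℚ≡mkℚ b = refl

  ℤ→ℚ-neg : ∀ a → ℤ→ℚ (ℤ.- a) ≡ - ℤ→ℚ a
  ℤ→ℚ-neg a = trans (ℤ→ℚ≡mkℚ (ℤ.- a)) (trans (mkℚ-neg a) (cong -_ (sym (ℤ→ℚ≡mkℚ a))))
    where
    mkℚ-neg : ∀ a → integral (ℤ.- a) ≡ - integral a
    mkℚ-neg (+ zero)  = refl
    mkℚ-neg (+ suc n) = refl
    mkℚ-neg -[1+ n ]  = refl

  ℤ→ℚ-- : ∀ a b → ℤ→ℚ (a ℤ.- b) ≡ ℤ→ℚ a - ℤ→ℚ b
  ℤ→ℚ-- a b = trans (ℤ→ℚ-+ a (ℤ.- b)) (cong (_+_ (ℤ→ℚ a)) (ℤ→ℚ-neg b))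

  ℕ→ℚ-+ : ∀ a b → ℕ→ℚ (a ℕ.+ b) ≡ ℕ→ℚ a + ℕ→ℚ b
  ℕ→ℚ-+ a b = ℤ→ℚ-+ (+ a) (+ b)

  ℕ→ℚ-* : ∀ a b → ℕ→ℚ (a ℕ.* b) ≡ ℕ→ℚ a * ℕ→ℚ b
  ℕ→ℚ-* a b = trans (cong ℤ→ℚ (ℤ.pos-* a b)) (ℤ→ℚ-* (+ a) (+ b))

  Σ< : ℕ → (ℕ → ℚ) → ℚ
  Σ< zero    f = 0ℚ
  Σ< (suc n) f = f 0 + Σ< n (f ∘ suc)

  sumUpTo≡Σ< : ∀ N f → sumUpTo N f ≡ Σ< (suc N) f
  sumUpTo≡Σ< N f = sum-applyUpTo (suc N) id
    where
    sum-applyUpTo : ∀ n g → sumℚ (map f (applyUpTo g n)) ≡ Σ< n (f ∘ g)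
    sum-applyUpTo zero    g = refl
    sum-applyUpTo (suc n) g = cong (_+_ (f (g 0))) (sum-applyUpTo n (g ∘ suc))

  Σ<-cong : ∀ n {f g} → (∀ {j} → j < n → f j ≡ g j) → Σ< n f ≡ Σ< n g
  Σ<-cong zero    f≡g = refl
  Σ<-cong (suc n) f≡g = cong₂ _+_ (f≡g (s≤s z≤n)) (Σ<-cong n (f≡g ∘ s≤s))

  Σ<-zero : ∀ n {f} → (∀ {j} → j < n → f j ≡ 0ℚ) → Σ< n f ≡ 0ℚ
  Σ<-zero zero    f≡0 = refl
  Σ<-zero (suc n) f≡0 rewrite f≡0 (s≤s z≤n) | Σ<-zero n (f≡0 ∘ s≤s) = refl

  Σ<-+ : ∀ n f g → Σ< n (λ j → f j + g j) ≡ Σ< n f + Σ< n g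
  Σ<-+ zero    f g = sym (ℚ.+-identityʳ 0ℚ)
  Σ<-+ (suc n) f g rewrite Σ<-+ n (f ∘ suc) (g ∘ suc) =
    solve 4 (λ a b c d → (a :+ b) :+ (c :+ d) := (a :+ c) :+ (b :+ d)) refl (f 0) (g 0) (Σ< n (f ∘ suc)) (Σ< n (g ∘ suc))
    where open +-*-Solver

  Σ<-* : ∀ n c f → Σ< n (λ j → c * f j) ≡ c * Σ< n f
  Σ<-* zero    c f = sym (ℚ.*-zeroʳ c)
  Σ<-* (suc n) c f rewrite Σ<-* n c (f ∘ suc) = sym (ℚ.*-distribˡ-+ c (f 0) (Σ< n (f ∘ suc)))

  Σ<-last : ∀ n f → Σ< (suc n) f ≡ Σ< n f + f n
  Σ<-last zero    f = trans (ℚ.+-identityʳ (f 0)) (sym (ℚ.+-identityˡ (f 0)))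
  Σ<-last (suc n) f rewrite Σ<-last n (f ∘ suc) = sym (ℚ.+-assoc (f 0) _ _)

  xTimes : (ℕ → ℚ) → ℕ → ℚ
  xTimes F zero    = 0ℚ
  xTimes F (suc b) = F b

  xTimes-cong : ∀ {F G} b → (∀ {b′} → b′ < b → F b′ ≡ G b′) → xTimes F b ≡ xTimes G b
  xTimes-cong zero    F≡G = refl
  xTimes-cong (suc b) F≡G = F≡G ℕ.≤-refl

  xTimes-linear : ∀ F a G b → xTimes (λ b′ → F b′ + a * G b′) b ≡ xTimes F b + a * xTimes G b
  xTimes-linear F a G zero    = sym (trans (cong (_+_ 0ℚ) (ℚ.*-zeroʳ a)) (ℚ.+-identityˡ 0ℚ))
  xTimes-linear F a G (suc b) = refl

  Σ<-xTimes : ∀ n (G : ℕ → ℕ → ℚ) b → Σ< n (λ j → xTimes (G j) b) ≡ xTimes (λ b′ → Σ< n (λ j → G j b′)) b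
  Σ<-xTimes n G zero    = Σ<-zero n (λ _ → refl)
  Σ<-xTimes n G (suc b) = refl

  Σ<-*-xTimes : ∀ n (w : ℕ → ℚ) (G : ℕ → ℕ → ℚ) b →
    Σ< n (λ j → w j * xTimes (G j) b) ≡ xTimes (λ b′ → Σ< n (λ j → w j * G j b′)) b
  Σ<-*-xTimes n w G zero    = Σ<-zero n (λ {j} _ → ℚ.*-zeroʳ (w j))
  Σ<-*-xTimes n w G (suc b) = refl

  mulLinear : ℚ → (ℕ → ℚ) → ℕ → ℚ
  mulLinear c F b = F b + c * xTimes F b

  mulLinear-cong : ∀ c {F G} b → (∀ {b′} → b′ ≤ b → F b′ ≡ G b′) → mulLinear c F b ≡ mulLinear c G b
  mulLinear-cong c b F≡G = cong₂ (λ x y → x + c * y) (F≡G ℕ.≤-refl) (xTimes-cong b (F≡G ∘ ℕ.<⇒≤))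

  mulLinear-comm : ∀ c d F b → mulLinear c (mulLinear d F) b ≡ mulLinear d (mulLinear c F) b
  mulLinear-comm c d F b
    rewrite xTimes-linear F d (xTimes F) b | xTimes-linear F c (xTimes F) b =
    solve 5 (λ c d x y z → (x :+ d :* y) :+ c :* (y :+ d :* z) := (x :+ c :* y) :+ d :* (y :+ c :* z))
      refl c d (F b) (xTimes F b) (xTimes (xTimes F) b)
    where open +-*-Solver

  -- powerCoeff c m k is the coefficient sequence of (1 + c x) ^ m (1 + x) ^ k.
  powerCoeff : ℚ → ℕ → ℕ → ℕ → ℚ
  powerCoeff c zero    k b = ℕ→ℚ (k C b)
  powerCoeff c (suc m) k b = mulLinear c (powerCoeff c m k) b

  powerCoeff-suc : ∀ c m k b → powerCoeff c m (suc k) b ≡ mulLinear 1ℚ (powerCoeff c m k) b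
  powerCoeff-suc c zero k zero = sym (trans (cong (_+_ 1ℚ) (ℚ.*-zeroʳ 1ℚ)) (ℚ.+-identityʳ 1ℚ))
  powerCoeff-suc c zero k (suc b) = begin
    ℕ→ℚ (suc k C suc b)                       ≡⟨ cong ℕ→ℚ (nCk+nC[k+1]≡[n+1]C[k+1] k b) ⟨
    ℕ→ℚ (k C b ℕ.+ k C suc b)                 ≡⟨ ℕ→ℚ-+ (k C b) (k C suc b) ⟩
    ℕ→ℚ (k C b) + ℕ→ℚ (k C suc b)             ≡⟨ solve 2 (λ x y → x :+ y := y :+ con 1ℚ :* x) refl
                                                    (ℕ→ℚ (k C b)) (ℕ→ℚ (k C suc b)) ⟩
    ℕ→ℚ (k C suc b) + 1ℚ * ℕ→ℚ (k C b)        ∎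
    where
    open ≡-Reasoning
    open +-*-Solver
  powerCoeff-suc c (suc m) k b = begin
    mulLinear c (powerCoeff c m (suc k)) b          ≡⟨ mulLinear-cong c b (λ {b′} _ → powerCoeff-suc c m k b′) ⟩
    mulLinear c (mulLinear 1ℚ (powerCoeff c m k)) b ≡⟨ mulLinear-comm c 1ℚ (powerCoeff c m k) b ⟩
    mulLinear 1ℚ (mulLinear c (powerCoeff c m k)) b ∎
    where open ≡-Reasoning

  ℤ→ℚ-mixedBinomial : ∀ s e d → ℤ→ℚ (mixedBinomial s e d) ≡ powerCoeff (- 1ℚ) s e d
  ℤ→ℚ-mixedBinomial zero    e d = refl
  ℤ→ℚ-mixedBinomial (suc s) e d = begin
    ℤ→ℚ (B d ℤ.- shift 1 B d)     ≡⟨ ℤ→ℚ-- (B d) (shift 1 B d) ⟩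
    ℤ→ℚ (B d) - ℤ→ℚ (shift 1 B d) ≡⟨ cong₂ _-_ (ℤ→ℚ-mixedBinomial s e d) (xTimes-cast d) ⟩
    P d - xTimes P d              ≡⟨ solve 2 (λ x y → x :- y := x :+ (:- con 1ℚ) :* y) refl (P d) (xTimes P d) ⟩
    mulLinear (- 1ℚ) P d          ∎
    where
    open ≡-Reasoning
    open +-*-Solver
    B : ℕ → ℤ
    B = mixedBinomial s e
    P : ℕ → ℚ
    P = powerCoeff (- 1ℚ) s e
    xTimes-cast : ∀ d → ℤ→ℚ (shift 1 (mixedBinomial s e) d) ≡ xTimes P d
    xTimes-cast zero    = refl
    xTimes-cast (suc d) = ℤ→ℚ-mixedBinomial s e d

  module Mixing (p c : ℚ) where

    weight : ℕ → ℕ → ℚ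
    weight m s = p ^ℚ (m ∸ s) * (1ℚ - p) ^ℚ s * ℕ→ℚ (m C s)

    mixture : ℕ → ℕ → ℕ → ℚ
    mixture m k b = Σ< (suc m) (λ s → weight m s * powerCoeff c s (m ∸ s ℕ.+ k) b)

    -- Binomial theorem for p (1 + x) + (1 - p) (1 + c x) = 1 + (p + (1 - p) c) x,
    -- with an extra factor (1 + x) ^ k.
    mixture≡powerCoeff : ∀ m k b → mixture m k b ≡ powerCoeff (p + (1ℚ - p) * c) m k b
    mixture≡powerCoeff zero k b =
      solve 1 (λ x → con 1ℚ :* con 1ℚ :* con 1ℚ :* x :+ con 0ℚ := x) refl (ℕ→ℚ (k C b))
      where open +-*-Solver
    mixture≡powerCoeff (suc m) k b = begin
      mixture (suc m) k b                                          ≡⟨ split ⟩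
      Σ< (suc (suc m)) F + Σ< (suc m) G                            ≡⟨ cong (_+ Σ< (suc m) G) dropLast ⟩
      Σ< (suc m) F + Σ< (suc m) G                                  ≡⟨ Σ<-+ (suc m) F G ⟨
      Σ< (suc m) (λ s → F s + G s)                                 ≡⟨ Σ<-cong (suc m) (λ s<m+1 → F+G (ℕ.≤-pred s<m+1)) ⟩
      Σ< (suc m) (λ s → weight m s * X s + a * (weight m s * Y s)) ≡⟨ collect ⟩
      mulLinear a (mixture m k) b                                  ≡⟨ mulLinear-cong a b (λ _ → mixture≡powerCoeff m k _) ⟩
      mulLinear a (powerCoeff a m k) b                             ∎
      where
      open ≡-Reasoning
      open +-*-Solver
      q = 1ℚ - p
      a = p + q * c
      X Y : ℕ → ℚ
      X s = powerCoeff c s (m ∸ s ℕ.+ k) b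
      Y s = xTimes (powerCoeff c s (m ∸ s ℕ.+ k)) b
      -- C (m + 1, s) = C (m, s) + C (m, s - 1) splits the sum into F and G, which recombine termwise.
      F G : ℕ → ℚ
      F s = p ^ℚ (suc m ∸ s) * q ^ℚ s * ℕ→ℚ (m C s) * powerCoeff c s (suc m ∸ s ℕ.+ k) b
      G s = p ^ℚ (m ∸ s) * q ^ℚ suc s * ℕ→ℚ (m C s) * powerCoeff c (suc s) (m ∸ s ℕ.+ k) b
      split : mixture (suc m) k b ≡ Σ< (suc (suc m)) F + Σ< (suc m) G
      split = begin
        F 0 + Σ< (suc m) (λ s → weight (suc m) (suc s) * powerCoeff c (suc s) (m ∸ s ℕ.+ k) b)
          ≡⟨ cong (_+_ (F 0)) (trans (Σ<-cong (suc m) (λ {s} _ → pascal s)) (Σ<-+ (suc m) G (F ∘ suc))) ⟩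
        F 0 + (Σ< (suc m) G + Σ< (suc m) (F ∘ suc))
          ≡⟨ solve 3 (λ x y z → x :+ (y :+ z) := (x :+ z) :+ y) refl (F 0) (Σ< (suc m) G) (Σ< (suc m) (F ∘ suc)) ⟩
        Σ< (suc (suc m)) F + Σ< (suc m) G ∎
        where
        pascal : ∀ s → weight (suc m) (suc s) * powerCoeff c (suc s) (m ∸ s ℕ.+ k) b ≡ G s + F (suc s)
        pascal s rewrite sym (nCk+nC[k+1]≡[n+1]C[k+1] m s) | ℕ→ℚ-+ (m C s) (m C suc s) =
          solve 5 (λ x y u v z → x :* y :* (u :+ v) :* z := x :* y :* u :* z :+ x :* y :* v :* z) refl
            (p ^ℚ (m ∸ s)) (q ^ℚ suc s) (ℕ→ℚ (m C s)) (ℕ→ℚ (m C suc s)) (powerCoeff c (suc s) (m ∸ s ℕ.+ k) b)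
      dropLast : Σ< (suc (suc m)) F ≡ Σ< (suc m) F
      dropLast = trans (Σ<-last (suc m) F) (trans (cong (_+_ (Σ< (suc m) F)) F[m+1]≡0) (ℚ.+-identityʳ (Σ< (suc m) F)))
        where
        F[m+1]≡0 : F (suc m) ≡ 0ℚ
        F[m+1]≡0 rewrite k>n⇒nCk≡0 (ℕ.n<1+n m) = solve 3 (λ x y z → x :* y :* con 0ℚ :* z := con 0ℚ) refl
          (p ^ℚ (suc m ∸ suc m)) (q ^ℚ suc m) (powerCoeff c (suc m) (suc m ∸ suc m ℕ.+ k) b)
      collect : Σ< (suc m) (λ s → weight m s * X s + a * (weight m s * Y s)) ≡ mulLinear a (mixture m k) b
      collect = trans (Σ<-+ (suc m) (λ s → weight m s * X s) (λ s → a * (weight m s * Y s)))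
        (cong (_+_ (mixture m k b)) (trans (Σ<-* (suc m) a (λ s → weight m s * Y s))
          (cong (a *_) (Σ<-*-xTimes (suc m) (weight m) (λ s → powerCoeff c s (m ∸ s ℕ.+ k)) b))))
      F+G : ∀ {s} → s ≤ m → F s + G s ≡ weight m s * X s + a * (weight m s * Y s)
      F+G {s} s≤m rewrite ℕ.+-∸-assoc 1 s≤m | powerCoeff-suc c s (m ∸ s ℕ.+ k) b =
        solve 7 (λ p u v w x y c → p :* u :* v :* w :* (x :+ con 1ℚ :* y) :+ u :* ((con 1ℚ :- p) :* v) :* w :* (x :+ c :* y)
                                 := u :* v :* w :* x :+ (p :+ (con 1ℚ :- p) :* c) :* (u :* v :* w :* y))
          refl p (p ^ℚ (m ∸ s)) (q ^ℚ s) (ℕ→ℚ (m C s)) (X s) (Y s) c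

  half? : ℕ → Maybe ℕ
  half? zero          = just zero
  half? (suc zero)    = nothing
  half? (suc (suc n)) = Maybe.map suc (half? n)

  -- diagonalIndex i j = just k exactly when i = j + 2 k.
  diagonalIndex : ℕ → ℕ → Maybe ℕ
  diagonalIndex i       zero    = half? i
  diagonalIndex zero    (suc j) = nothing
  diagonalIndex (suc i) (suc j) = diagonalIndex i j

  atIndex : Maybe ℕ → (ℕ → ℚ) → ℚ
  atIndex (just k) F = F k
  atIndex nothing  F = 0ℚ

  atIndex-cong : ∀ m {F G} → (∀ k → F k ≡ G k) → atIndex m F ≡ atIndex m G
  atIndex-cong (just k) F≡G = F≡G k
  atIndex-cong nothing  F≡G = refl

  atIndex-zero : ∀ m {F} → (∀ k → F k ≡ 0ℚ) → atIndex m F ≡ 0ℚ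
  atIndex-zero (just k) F≡0 = F≡0 k
  atIndex-zero nothing  F≡0 = refl

  atIndex-linear : ∀ m F a G b H → atIndex m (λ k → F k + a * G k + b * H k) ≡ atIndex m F + a * atIndex m G + b * atIndex m H
  atIndex-linear (just k) F a G b H = refl
  atIndex-linear nothing  F a G b H =
    solve 2 (λ a b → con 0ℚ := con 0ℚ :+ a :* con 0ℚ :+ b :* con 0ℚ) refl a b
    where open +-*-Solver

  atIndex-map-suc : ∀ m F → atIndex (Maybe.map suc m) F ≡ atIndex m (F ∘ suc)
  atIndex-map-suc (just k) F = refl
  atIndex-map-suc nothing  F = refl

  trinomial : ℕ → ℕ → ℕ → ℕ
  trinomial N j k = (N C j) ℕ.* ((N ∸ j) C k)

  module _ where
    open import Data.Nat.Solver as ℕ-Solver using ()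
    open ℕ-Solver.+-*-Solver

    trinomial-pascal-0s : ∀ N k → trinomial (suc N) 0 (suc k) ≡ trinomial N 0 (suc k) ℕ.+ trinomial N 0 k
    trinomial-pascal-0s N k = trans (cong (1 ℕ.*_) (sym (nCk+nC[k+1]≡[n+1]C[k+1] N k)))
      (solve 2 (λ a b → con 1 :* (a :+ b) := con 1 :* b :+ con 1 :* a) refl (N C k) (N C suc k))

    trinomial-pascal-s0 : ∀ N j → trinomial (suc N) (suc j) 0 ≡ trinomial N (suc j) 0 ℕ.+ trinomial N j 0
    trinomial-pascal-s0 N j = trans (cong (ℕ._* 1) (sym (nCk+nC[k+1]≡[n+1]C[k+1] N j)))
      (solve 2 (λ a b → (a :+ b) :* con 1 := b :* con 1 :+ a :* con 1) refl (N C j) (N C suc j))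

    trinomial-pascal-ss : ∀ N j k → trinomial (suc N) (suc j) (suc k) ≡
      trinomial N (suc j) (suc k) ℕ.+ trinomial N j (suc k) ℕ.+ trinomial N (suc j) k
    trinomial-pascal-ss N j k with j ℕ.<? N
    ... | yes j<N = begin
      (suc N C suc j) ℕ.* ((N ∸ j) C suc k)       ≡⟨ cong₂ ℕ._*_ (sym (nCk+nC[k+1]≡[n+1]C[k+1] N j)) split ⟩
      (a ℕ.+ b) ℕ.* (c ℕ.+ d)                     ≡⟨ solve 4 (λ a b c d → (a :+ b) :* (c :+ d) := b :* d :+ a :* (c :+ d) :+ b :* c) refl a b c d ⟩
      b ℕ.* d ℕ.+ a ℕ.* (c ℕ.+ d) ℕ.+ b ℕ.* c     ≡⟨ cong (λ x → b ℕ.* d ℕ.+ a ℕ.* x ℕ.+ b ℕ.* c) split ⟨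
      b ℕ.* d ℕ.+ a ℕ.* ((N ∸ j) C suc k) ℕ.+ b ℕ.* c ∎
      where
      open ≡-Reasoning
      a = N C j
      b = N C suc j
      c = (N ∸ suc j) C k
      d = (N ∸ suc j) C suc k
      split : (N ∸ j) C suc k ≡ c ℕ.+ d
      split = trans (cong (_C suc k) (ℕ.+-∸-assoc 1 j<N)) (sym (nCk+nC[k+1]≡[n+1]C[k+1] (N ∸ suc j) k))
    ... | no j≮N rewrite sym (nCk+nC[k+1]≡[n+1]C[k+1] N j) | k>n⇒nCk≡0 (s≤s (ℕ.≮⇒≥ j≮N)) =
      solve 4 (λ a c d e → (a :+ con 0) :* c := con 0 :* d :+ a :* c :+ con 0 :* e)
        refl (N C j) ((N ∸ j) C suc k) ((N ∸ suc j) C suc k) ((N ∸ suc j) C k)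

  -- The term of ((1 + x) (1 + c x)) ^ N = (1 + (1 + c) x + c x²) ^ N in which j factors
  -- contribute (1 + c) x and k factors contribute c x².
  trinomialTerm : ℚ → ℕ → ℕ → ℕ → ℚ
  trinomialTerm c N j k = ℕ→ℚ (trinomial N j k) * (1ℚ + c) ^ℚ j * c ^ℚ k

  trinomialTerm-pascal : ∀ c N j k → trinomialTerm c (suc N) j k ≡
    trinomialTerm c N j k + (1ℚ + c) * xTimes (λ j′ → trinomialTerm c N j′ k) j + c * xTimes (trinomialTerm c N j) k
  trinomialTerm-pascal c N zero zero =
    solve 2 (λ x c → x := x :+ (con 1ℚ :+ c) :* con 0ℚ :+ c :* con 0ℚ) refl (trinomialTerm c N 0 0) c
    where open +-*-Solver
  trinomialTerm-pascal c N zero (suc k) =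
    trans (cong (λ x → x * 1ℚ * (c * c ^ℚ k)) (trans (cong ℕ→ℚ (trinomial-pascal-0s N k)) (ℕ→ℚ-+ u v)))
      (solve 4 (λ u v c ck → (u :+ v) :* con 1ℚ :* (c :* ck)
                           := u :* con 1ℚ :* (c :* ck) :+ (con 1ℚ :+ c) :* con 0ℚ :+ c :* (v :* con 1ℚ :* ck))
        refl (ℕ→ℚ u) (ℕ→ℚ v) c (c ^ℚ k))
    where
    open +-*-Solver
    u = trinomial N 0 (suc k)
    v = trinomial N 0 k
  trinomialTerm-pascal c N (suc j) zero =
    trans (cong (λ x → x * ((1ℚ + c) * (1ℚ + c) ^ℚ j) * 1ℚ) (trans (cong ℕ→ℚ (trinomial-pascal-s0 N j)) (ℕ→ℚ-+ u v)))
      (solve 4 (λ u v c xj → (u :+ v) :* ((con 1ℚ :+ c) :* xj) :* con 1ℚ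
                           := u :* ((con 1ℚ :+ c) :* xj) :* con 1ℚ :+ (con 1ℚ :+ c) :* (v :* xj :* con 1ℚ) :+ c :* con 0ℚ)
        refl (ℕ→ℚ u) (ℕ→ℚ v) c ((1ℚ + c) ^ℚ j))
    where
    open +-*-Solver
    u = trinomial N (suc j) 0
    v = trinomial N j 0
  trinomialTerm-pascal c N (suc j) (suc k) =
    trans (cong (λ x → x * ((1ℚ + c) * (1ℚ + c) ^ℚ j) * (c * c ^ℚ k))
            (trans (cong ℕ→ℚ (trinomial-pascal-ss N j k))
                   (trans (ℕ→ℚ-+ (u ℕ.+ v) w) (cong (_+ ℕ→ℚ w) (ℕ→ℚ-+ u v)))))
      (solve 6 (λ u v w c xj ck → (u :+ v :+ w) :* ((con 1ℚ :+ c) :* xj) :* (c :* ck)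
                                := u :* ((con 1ℚ :+ c) :* xj) :* (c :* ck) :+ (con 1ℚ :+ c) :* (v :* xj :* (c :* ck))
                                   :+ c :* (w :* ((con 1ℚ :+ c) :* xj) :* ck))
        refl (ℕ→ℚ u) (ℕ→ℚ v) (ℕ→ℚ w) c ((1ℚ + c) ^ℚ j) (c ^ℚ k))
    where
    open +-*-Solver
    u = trinomial N (suc j) (suc k)
    v = trinomial N j (suc k)
    w = trinomial N (suc j) k

  diagonalTerm : ℚ → ℕ → ℕ → ℕ → ℚ
  diagonalTerm c N i j = atIndex (diagonalIndex i j) (trinomialTerm c N j)

  xTimes-0 : ∀ b → xTimes (λ _ → 0ℚ) b ≡ 0ℚ
  xTimes-0 zero    = refl
  xTimes-0 (suc b) = refl

  atIndex-diagonal-xTimesʲ : ∀ (T : ℕ → ℕ → ℚ) i j → atIndex (diagonalIndex i j) (λ k → xTimes (λ j′ → T j′ k) j) ≡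
    xTimes (λ i′ → xTimes (λ j′ → atIndex (diagonalIndex i′ j′) (T j′)) j) i
  atIndex-diagonal-xTimesʲ T i       zero    = trans (atIndex-zero (half? i) (λ _ → refl)) (sym (xTimes-0 i))
  atIndex-diagonal-xTimesʲ T zero    (suc j) = refl
  atIndex-diagonal-xTimesʲ T (suc i) (suc j) = refl

  atIndex-diagonal-xTimesᵏ : ∀ F i j → atIndex (diagonalIndex i j) (xTimes F) ≡
    xTimes (xTimes (λ i′ → atIndex (diagonalIndex i′ j) F)) i
  atIndex-diagonal-xTimesᵏ F zero                zero    = refl
  atIndex-diagonal-xTimesᵏ F (suc zero)          zero    = refl
  atIndex-diagonal-xTimesᵏ F (suc (suc i))       zero    = atIndex-map-suc (half? i) (xTimes F)
  atIndex-diagonal-xTimesᵏ F zero                (suc j) = refl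
  atIndex-diagonal-xTimesᵏ F (suc zero)          (suc j) = atIndex-diagonal-xTimesᵏ F zero j
  atIndex-diagonal-xTimesᵏ F (suc (suc zero))    (suc j) = atIndex-diagonal-xTimesᵏ F (suc zero) j
  atIndex-diagonal-xTimesᵏ F (suc (suc (suc i))) (suc j) = atIndex-diagonal-xTimesᵏ F (suc (suc i)) j

  diagonalTerm-pascal : ∀ c N i j → diagonalTerm c (suc N) i j ≡
    diagonalTerm c N i j + (1ℚ + c) * xTimes (λ i′ → xTimes (diagonalTerm c N i′) j) i
                         + c * xTimes (xTimes (λ i′ → diagonalTerm c N i′ j)) i
  diagonalTerm-pascal c N i j = begin
    atIndex (diagonalIndex i j) (trinomialTerm c (suc N) j)
      ≡⟨ atIndex-cong (diagonalIndex i j) (trinomialTerm-pascal c N j) ⟩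
    atIndex (diagonalIndex i j) (λ k → T j k + (1ℚ + c) * xTimes (λ j′ → T j′ k) j + c * xTimes (T j) k)
      ≡⟨ atIndex-linear (diagonalIndex i j) (T j) (1ℚ + c) (λ k → xTimes (λ j′ → T j′ k) j) c (xTimes (T j)) ⟩
    diagonalTerm c N i j + (1ℚ + c) * atIndex (diagonalIndex i j) (λ k → xTimes (λ j′ → T j′ k) j)
                         + c * atIndex (diagonalIndex i j) (xTimes (T j))
      ≡⟨ cong₂ (λ u v → diagonalTerm c N i j + (1ℚ + c) * u + c * v)
               (atIndex-diagonal-xTimesʲ T i j) (atIndex-diagonal-xTimesᵏ (T j) i j) ⟩
    diagonalTerm c N i j + (1ℚ + c) * xTimes (λ i′ → xTimes (diagonalTerm c N i′) j) i
                         + c * xTimes (xTimes (λ i′ → diagonalTerm c N i′ j)) i ∎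
    where
    open ≡-Reasoning
    T : ℕ → ℕ → ℚ
    T = trinomialTerm c N

  Σ<-diagonalTerm-pascal : ∀ c N L i → Σ< (suc L) (diagonalTerm c (suc N) i) ≡
    Σ< (suc L) (diagonalTerm c N i) + (1ℚ + c) * xTimes (λ i′ → Σ< L (diagonalTerm c N i′)) i
    + c * xTimes (xTimes (λ i′ → Σ< (suc L) (diagonalTerm c N i′))) i
  Σ<-diagonalTerm-pascal c N L i = begin
    Σ< (suc L) (diagonalTerm c (suc N) i)             ≡⟨ Σ<-cong (suc L) (λ {j} _ → diagonalTerm-pascal c N i j) ⟩
    Σ< (suc L) (λ j → A j + (1ℚ + c) * B j + c * C j) ≡⟨ Σ<-+ (suc L) (λ j → A j + (1ℚ + c) * B j) (λ j → c * C j) ⟩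
    Σ< (suc L) (λ j → A j + (1ℚ + c) * B j) + Σ< (suc L) (λ j → c * C j)
      ≡⟨ cong₂ _+_ (trans (Σ<-+ (suc L) A (λ j → (1ℚ + c) * B j)) (cong (_+_ (Σ< (suc L) A)) (Σ<-* (suc L) (1ℚ + c) B)))
                   (Σ<-* (suc L) c C) ⟩
    Σ< (suc L) A + (1ℚ + c) * Σ< (suc L) B + c * Σ< (suc L) C
      ≡⟨ cong₂ (λ u v → Σ< (suc L) A + (1ℚ + c) * u + c * v) ΣB ΣC ⟩
    Σ< (suc L) A + (1ℚ + c) * xTimes (λ i′ → Σ< L (diagonalTerm c N i′)) i
      + c * xTimes (xTimes (λ i′ → Σ< (suc L) (diagonalTerm c N i′))) i ∎
    where
    open ≡-Reasoning
    A B C : ℕ → ℚ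
    A = diagonalTerm c N i
    B j = xTimes (λ i′ → xTimes (diagonalTerm c N i′) j) i
    C j = xTimes (xTimes (λ i′ → diagonalTerm c N i′ j)) i
    ΣB : Σ< (suc L) B ≡ xTimes (λ i′ → Σ< L (diagonalTerm c N i′)) i
    ΣB = trans (Σ<-xTimes (suc L) (λ j i′ → xTimes (diagonalTerm c N i′) j) i)
               (xTimes-cong i (λ _ → ℚ.+-identityˡ _))
    ΣC : Σ< (suc L) C ≡ xTimes (xTimes (λ i′ → Σ< (suc L) (diagonalTerm c N i′))) i
    ΣC = trans (Σ<-xTimes (suc L) (λ j i′ → xTimes (λ i″ → diagonalTerm c N i″ j) i′) i)
               (xTimes-cong i (λ {i′} _ → Σ<-xTimes (suc L) (λ j i″ → diagonalTerm c N i″ j) i′))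

  powerCoeff-square-suc : ∀ c N i → powerCoeff c (suc N) (suc N) i ≡
    powerCoeff c N N i + (1ℚ + c) * xTimes (powerCoeff c N N) i + c * xTimes (xTimes (powerCoeff c N N)) i
  powerCoeff-square-suc c N i = begin
    mulLinear c (powerCoeff c N (suc N)) i   ≡⟨ mulLinear-cong c i (λ {b} _ → powerCoeff-suc c N N b) ⟩
    mulLinear c (mulLinear 1ℚ P) i           ≡⟨ cong (λ z → P i + 1ℚ * xTimes P i + c * z) (xTimes-linear P 1ℚ (xTimes P) i) ⟩
    P i + 1ℚ * xTimes P i + c * (xTimes P i + 1ℚ * xTimes (xTimes P) i)
      ≡⟨ solve 4 (λ x y z c → x :+ con 1ℚ :* y :+ c :* (y :+ con 1ℚ :* z) := x :+ (con 1ℚ :+ c) :* y :+ c :* z)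
           refl (P i) (xTimes P i) (xTimes (xTimes P) i) c ⟩
    P i + (1ℚ + c) * xTimes P i + c * xTimes (xTimes P) i ∎
    where
    open ≡-Reasoning
    open +-*-Solver
    P : ℕ → ℚ
    P = powerCoeff c N N

  -- Expansion of ((1 + x) (1 + c x)) ^ N by the trinomial theorem; any range of j covering 0, …, i will do.
  trinomial-expansion : ∀ c N L i → i < L → Σ< L (diagonalTerm c N i) ≡ powerCoeff c N N i
  trinomial-expansion c zero (suc L) i _ =
    trans (cong₂ _+_ (constantTerm i) (Σ<-zero L (λ {j} _ → atIndex-zero (diagonalIndex i (suc j)) (noLinear j))))
          (ℚ.+-identityʳ _)
    where
    noLinear : ∀ j k → trinomialTerm c 0 (suc j) k ≡ 0ℚ
    noLinear j k = trans (cong (_* c ^ℚ k) (ℚ.*-zeroˡ ((1ℚ + c) ^ℚ suc j))) (ℚ.*-zeroˡ (c ^ℚ k))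
    noQuadratic : ∀ k → trinomialTerm c 0 0 (suc k) ≡ 0ℚ
    noQuadratic k = trans (cong (_* c ^ℚ suc k) (ℚ.*-zeroˡ 1ℚ)) (ℚ.*-zeroˡ (c ^ℚ suc k))
    constantTerm : ∀ i → atIndex (half? i) (trinomialTerm c 0 0) ≡ ℕ→ℚ (0 C i)
    constantTerm zero          = refl
    constantTerm (suc zero)    = refl
    constantTerm (suc (suc i)) = trans (atIndex-map-suc (half? i) _) (atIndex-zero (half? i) noQuadratic)
  trinomial-expansion c (suc N) (suc L) i i<L = begin
    Σ< (suc L) (diagonalTerm c (suc N) i)                   ≡⟨ Σ<-diagonalTerm-pascal c N L i ⟩
    W (suc L) i + (1ℚ + c) * xTimes (W L) i + c * xTimes (xTimes (W (suc L))) i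
      ≡⟨ cong₂ (λ u v → u + (1ℚ + c) * v + c * xTimes (xTimes (W (suc L))) i)
               (trinomial-expansion c N (suc L) i i<L)
               (xTimes-cong i (λ i′<i → trinomial-expansion c N L _ (ℕ.≤-trans i′<i (ℕ.≤-pred i<L)))) ⟩
    P i + (1ℚ + c) * xTimes P i + c * xTimes (xTimes (W (suc L))) i
      ≡⟨ cong (λ z → P i + (1ℚ + c) * xTimes P i + c * z)
              (xTimes-cong i (λ {i′} i′<i → xTimes-cong i′ (λ i″<i′ →
                 trinomial-expansion c N (suc L) _ (ℕ.<-trans i″<i′ (ℕ.<-trans i′<i i<L))))) ⟩
    P i + (1ℚ + c) * xTimes P i + c * xTimes (xTimes P) i ≡⟨ powerCoeff-square-suc c N i ⟨
    powerCoeff c (suc N) (suc N) i                         ∎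
    where
    open ≡-Reasoning
    W : ℕ → ℕ → ℚ
    W L i′ = Σ< L (diagonalTerm c N i′)
    P : ℕ → ℚ
    P = powerCoeff c N N

module MultinomialDecoding where

  open CoefficientSequences
  open import Data.Bool.Base using (true; T)
  open import Data.Unit.Base using (tt)
  open import Data.Maybe.Base as Maybe using (Maybe; just; nothing)
  open import Data.Nat.Base as ℕ using (ℕ; zero; suc; _∸_; _≤_; _<_; _!; _≡ᵇ_; z≤n; s≤s)
  import Data.Nat.Properties as ℕ
  open import Data.Nat.Combinatorics using (_C_; nCk≡n!/k![n-k]!; k![n∸k]!∣n!; k>n⇒nCk≡0)
  open import Data.Nat.DivMod using (m/n*n≡m; m*n/n≡m)
  open import Data.Nat.Divisibility using (divides; ∣-antisym; ∣-refl)
  open import Data.Nat.GCD as GCD using ()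
  open import Data.Integer.Base as ℤ using (ℤ; +_; -[1+_]; _⊖_)
  import Data.Integer.Properties as ℤ
  open import Data.Rational.Base as ℚ using (ℚ; 0ℚ; 1ℚ; _+_; _*_; _-_)
  open import Data.Rational.Solver using (module +-*-Solver)
  import Data.Rational.Properties as ℚ
  open import Data.Product.Base using (_×_; _,_)
  open import Relation.Nullary.Decidable using (yes; no; dec-true)
  import Data.Nat.Solver as ℕ-Solver
  import Data.Integer.Solver as ℤ-Solver
  open import Relation.Nullary.Negation using (contradiction)
  open import Relation.Binary.PropositionalEquality

  half?-double : ∀ k → half? (k ℕ.+ k) ≡ just k
  half?-double zero    = refl
  half?-double (suc k) rewrite ℕ.+-suc k k | half?-double k = refl

  half?-just : ∀ n {k} → half? n ≡ just k → n ≡ k ℕ.+ k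
  half?-just zero          refl = refl
  half?-just (suc (suc n)) eq with half? n in h
  ... | just k′ with refl ← eq = cong suc (trans (cong suc (half?-just n h)) (sym (ℕ.+-suc k′ k′)))

  diagonalIndex-just : ∀ i j {k} → diagonalIndex i j ≡ just k → i ≡ j ℕ.+ (k ℕ.+ k)
  diagonalIndex-just i       zero    eq = half?-just i eq
  diagonalIndex-just (suc i) (suc j) eq = cong suc (diagonalIndex-just i j eq)

  diagonalIndex-double-≤ : ∀ {a b} → b ≤ a → diagonalIndex (a ℕ.+ a) (b ℕ.+ b) ≡ just (a ∸ b)
  diagonalIndex-double-≤ {a} {zero}  z≤n = half?-double a
  diagonalIndex-double-≤ {suc a} {suc b} (s≤s b≤a) rewrite ℕ.+-suc a a | ℕ.+-suc b b = diagonalIndex-double-≤ b≤a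

  diagonalIndex-double-> : ∀ {a b} → a < b → diagonalIndex (a ℕ.+ a) (b ℕ.+ b) ≡ nothing
  diagonalIndex-double-> {zero}  {suc b} _ = refl
  diagonalIndex-double-> {suc a} {suc b} (s≤s a<b) rewrite ℕ.+-suc a a | ℕ.+-suc b b = diagonalIndex-double-> a<b

  halfℤ? : ℤ → Maybe ℕ
  halfℤ? (+ n)    = half? n
  halfℤ? -[1+ _ ] = nothing

  halfℤ?-⊖ : ∀ i j → halfℤ? (i ⊖ j) ≡ diagonalIndex i j
  halfℤ?-⊖ i       zero    = refl
  halfℤ?-⊖ zero    (suc j) = refl
  halfℤ?-⊖ (suc i) (suc j) = trans (cong halfℤ? (ℤ.[1+m]⊖[1+n]≡m⊖n i j)) (halfℤ?-⊖ i j)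

  toℕ?-just : ∀ q {x} → toℕ? q ≡ just x → ℚ.denominatorℕ q ≡ 1 × ℚ.numerator q ≡ + x
  toℕ?-just q eq with ℚ.denominatorℕ q ≡ᵇ 1 in d | ℚ.numerator q in n
  toℕ?-just q refl | true | + k = ℕ.≡ᵇ⇒≡ _ 1 (subst T (sym d) tt) , refl

  toℕ?-intro : ∀ q {x} → ℚ.denominatorℕ q ≡ 1 → ℚ.numerator q ≡ + x → toℕ? q ≡ just x
  toℕ?-intro q d n rewrite ℕ.suc-injective d | n = refl

  toℕ?-ℕ : ∀ j → toℕ? (ℕ→ℚ j) ≡ just j
  toℕ?-ℕ j rewrite ℤ→ℚ≡mkℚ (+ j) = refl

  m*2≡m+m : ∀ m → m ℕ.* 2 ≡ m ℕ.+ m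
  m*2≡m+m m = trans (ℕ.*-comm m 2) (cong (m ℕ.+_) (ℕ.+-identityʳ m))

  m*2/2≡m : ∀ m → m ℕ.* 2 ℕ./ 2 ≡ m
  m*2/2≡m m = m*n/n≡m m 2

  double/2 : ∀ k → (k ℕ.+ k) ℕ./ 2 ≡ k
  double/2 k = trans (cong (ℕ._/ 2) (sym (m*2≡m+m k))) (m*2/2≡m k)

  double≡*2 : ∀ k → + (k ℕ.+ k) ≡ + k ℤ.* + 2
  double≡*2 k = trans (cong +_ (sym (m*2≡m+m k))) (ℤ.pos-* k 2)

  toℕ?-ℤ/2-double : ∀ k → toℕ? (ℤ/2 (+ (k ℕ.+ k))) ≡ just k
  toℕ?-ℤ/2-double k = toℕ?-intro q
    (cong ℤ.∣_∣ (ℤ.*-cancelʳ-≡ (ℚ.denominator q) (+ 1) (+ 2) denominator*2))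
    (ℤ.*-cancelʳ-≡ (ℚ.numerator q) (+ k) (+ 2) numerator*2)
    where
    q = ℤ/2 (+ (k ℕ.+ k))
    gcd≡2 : GCD.gcd (k ℕ.+ k) 2 ≡ 2
    gcd≡2 = ∣-antisym (GCD.gcd[m,n]∣n (k ℕ.+ k) 2) (GCD.gcd-greatest (divides k (sym (m*2≡m+m k))) ∣-refl)
    denominator*2 : ℚ.denominator q ℤ.* + 2 ≡ + 2
    denominator*2 = subst (λ g → ℚ.denominator q ℤ.* + g ≡ + 2) gcd≡2 (ℚ.↧-/ (+ (k ℕ.+ k)) 2)
    numerator*2 : ℚ.numerator q ℤ.* + 2 ≡ + k ℤ.* + 2
    numerator*2 = trans (subst (λ g → ℚ.numerator q ℤ.* + g ≡ + (k ℕ.+ k)) gcd≡2 (ℚ.↥-/ (+ (k ℕ.+ k)) 2)) (double≡*2 k)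

  toℕ?-ℤ/2-just : ∀ z {x} → toℕ? (ℤ/2 z) ≡ just x → z ≡ + (x ℕ.+ x)
  toℕ?-ℤ/2-just z {x} eq with toℕ?-just (ℤ/2 z) eq
  ... | den≡1 , num≡x = begin
    z                                                     ≡⟨ ℚ.↥-/ z 2 ⟨
    ℚ.numerator (ℤ/2 z) ℤ.* + GCD.gcd ℤ.∣ z ∣ 2           ≡⟨ cong₂ ℤ._*_ num≡x gcd≡2 ⟩
    + x ℤ.* + 2                                           ≡⟨ double≡*2 x ⟨
    + (x ℕ.+ x)                                           ∎
    where
    open ≡-Reasoning
    gcd≡2 : + GCD.gcd ℤ.∣ z ∣ 2 ≡ + 2
    gcd≡2 = trans (sym (ℤ.*-identityˡ _)) (trans (cong (λ d → + d ℤ.* + GCD.gcd ℤ.∣ z ∣ 2) (sym den≡1)) (ℚ.↧-/ z 2))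

  toℕ?-ℤ/2 : ∀ z → toℕ? (ℤ/2 z) ≡ halfℤ? z
  toℕ?-ℤ/2 (+ n) with half? n in h
  ... | just k = trans (cong (λ m → toℕ? (ℤ/2 (+ m))) (half?-just n h)) (toℕ?-ℤ/2-double k)
  ... | nothing with toℕ? (ℤ/2 (+ n)) in t
  ...   | nothing = refl
  ...   | just x = contradiction (trans (sym (half?-double x)) (trans (cong half? (sym n≡x+x)) h)) λ ()
    where n≡x+x = ℤ.+-injective (toℕ?-ℤ/2-just (+ n) t)
  toℕ?-ℤ/2 -[1+ n ] with toℕ? (ℤ/2 -[1+ n ]) in t
  ... | nothing = refl
  ... | just x = contradiction (toℕ?-ℤ/2-just -[1+ n ] t) λ ()

  multinomial-nothing₂ : ∀ N a b c → toℕ? b ≡ nothing → multinomial N a b c ≡ 0ℚ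
  multinomial-nothing₂ N a b c b? with toℕ? a
  ... | nothing = refl
  ... | just _ rewrite b? = refl

  multinomial-nothing₃ : ∀ N a b c → toℕ? c ≡ nothing → multinomial N a b c ≡ 0ℚ
  multinomial-nothing₃ N a b c c? with toℕ? a | toℕ? b
  ... | nothing | _      = refl
  ... | just _  | nothing = refl
  ... | just _  | just _ rewrite c? = refl

  multinomial-just : ∀ N a b c {a′ b′ c′} → toℕ? a ≡ just a′ → toℕ? b ≡ just b′ → toℕ? c ≡ just c′ →
    a′ ℕ.+ b′ ℕ.+ c′ ≡ N → multinomial N a b c ≡ ℕ→ℚ (N !) ÷ℚ ℕ→ℚ ((a′ !) ℕ.* (b′ !) ℕ.* (c′ !))
  multinomial-just N a b c a? b? c? sum≡N rewrite a? | b? | c? | dec-true (_ ℕ.≟ N) sum≡N = refl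

  ℕ→ℚ-*÷ℚ : ∀ x y → y ≢ 0 → ℕ→ℚ (x ℕ.* y) ÷ℚ ℕ→ℚ y ≡ ℕ→ℚ x
  ℕ→ℚ-*÷ℚ x y y≢0 with ℕ→ℚ y ℚ.≟ 0ℚ
  ... | yes y≡0 = contradiction (ℤ.+-injective (cong ℚ.numerator (trans (sym (ℤ→ℚ≡mkℚ (+ y))) y≡0))) y≢0
  ... | no  y≢0ℚ = begin
    ℕ→ℚ (x ℕ.* y) * ℚ.1/ ℕ→ℚ y      ≡⟨ cong (_* ℚ.1/ ℕ→ℚ y) (ℕ→ℚ-* x y) ⟩
    ℕ→ℚ x * ℕ→ℚ y * ℚ.1/ ℕ→ℚ y       ≡⟨ ℚ.*-assoc (ℕ→ℚ x) (ℕ→ℚ y) _ ⟩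
    ℕ→ℚ x * (ℕ→ℚ y * ℚ.1/ ℕ→ℚ y)     ≡⟨ cong (ℕ→ℚ x *_) (ℚ.*-inverseʳ (ℕ→ℚ y)) ⟩
    ℕ→ℚ x * 1ℚ                        ≡⟨ ℚ.*-identityʳ (ℕ→ℚ x) ⟩
    ℕ→ℚ x                             ∎
    where
    open ≡-Reasoning
    instance _ = ℚ.≢-nonZero y≢0ℚ

  C*factorials : ∀ {n k} → k ≤ n → (n C k) ℕ.* (k ! ℕ.* (n ∸ k) !) ≡ n !
  C*factorials {n} {k} k≤n =
    trans (cong (ℕ._* (k ! ℕ.* (n ∸ k) !)) (nCk≡n!/k![n-k]! k≤n)) (m/n*n≡m (k![n∸k]!∣n! k≤n))
    where instance _ = k ℕ.!* (n ∸ k) !≢0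

  trinomial*factorials : ∀ {N j k} → j ℕ.+ k ≤ N → trinomial N j k ℕ.* ((j !) ℕ.* (k !) ℕ.* ((N ∸ (j ℕ.+ k)) !)) ≡ N !
  trinomial*factorials {N} {j} {k} j+k≤N = begin
    trinomial N j k ℕ.* (j ! ℕ.* k ! ℕ.* (N ∸ (j ℕ.+ k)) !)
      ≡⟨ cong (λ m → trinomial N j k ℕ.* (j ! ℕ.* k ! ℕ.* m !)) (sym (ℕ.∸-+-assoc N j k)) ⟩
    trinomial N j k ℕ.* (j ! ℕ.* k ! ℕ.* (N ∸ j ∸ k) !)
      ≡⟨ solve 5 (λ a b x y z → a :* b :* (x :* y :* z) := a :* (x :* (b :* (y :* z)))) refl
           (N C j) ((N ∸ j) C k) (j !) (k !) ((N ∸ j ∸ k) !) ⟩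
    (N C j) ℕ.* (j ! ℕ.* (((N ∸ j) C k) ℕ.* (k ! ℕ.* (N ∸ j ∸ k) !)))
      ≡⟨ cong (λ m → (N C j) ℕ.* (j ! ℕ.* m)) (C*factorials (ℕ.m+n≤o⇒m≤o∸n k (subst (ℕ._≤ N) (ℕ.+-comm j k) j+k≤N))) ⟩
    (N C j) ℕ.* (j ! ℕ.* (N ∸ j) !)  ≡⟨ C*factorials (ℕ.m+n≤o⇒m≤o j j+k≤N) ⟩
    N !                               ∎
    where
    open ≡-Reasoning
    open ℕ-Solver.+-*-Solver

  trinomial-vanish : ∀ {N j k} → N < j ℕ.+ k → trinomial N j k ≡ 0
  trinomial-vanish {N} {j} {k} N<j+k with j ℕ.≤? N
  ... | no  j≰N = cong (λ x → x ℕ.* ((N ∸ j) C k)) (k>n⇒nCk≡0 (ℕ.≰⇒> j≰N))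
  ... | yes j≤N = trans (cong (ℕ._*_ (N C j)) (k>n⇒nCk≡0 N∸j<k)) (ℕ.*-zeroʳ (N C j))
    where
    N∸j<k : N ∸ j < k
    N∸j<k = ℕ.+-cancelˡ-< j (N ∸ j) k (subst (ℕ._< j ℕ.+ k) (sym (ℕ.m+[n∸m]≡n j≤N)) N<j+k)

  0*x*y≡0 : ∀ x y → 0ℚ * x * y ≡ 0ℚ
  0*x*y≡0 x y = trans (cong (_* y) (ℚ.*-zeroˡ x)) (ℚ.*-zeroˡ y)

  -- termA M and termB M are the two summands on the right-hand side of the theorem for n = 2 (N + 1),
  -- with M standing for n / 2 ∸ 1, a for 2 p and c for 2 p - 1.
  module StatementTerms (N : ℕ) (a c : ℚ) (a≡1+c : a ≡ 1ℚ + c) where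

    lower₂ lower₃ : ℕ → ℕ → ℤ
    lower₂ i j = + i ℤ.- + j
    lower₃ i j = + (suc N ℕ.* 2) ℤ.- + i ℤ.- + j ℤ.- + 2

    termA : ℕ → ℕ → ℕ → ℚ
    termA M i j = multinomial M (ℕ→ℚ j) (ℤ/2 (lower₂ i j)) (ℤ/2 (lower₃ i j)) * a ^ℚ j * c ^ℚ ((i ∸ j) ℕ./ 2)

    termB : ℕ → ℕ → ℕ → ℚ
    termB M i j = multinomial M (ℕ→ℚ j) (ℤ/2 (+ i ℤ.- + j ℤ.- + 1)) (ℤ/2 (+ (suc N ℕ.* 2) ℤ.- + i ℤ.- + j ℤ.- + 1))
                  * a ^ℚ j * c ^ℚ (((i ∸ j ∸ 1) ℕ./ 2) ℕ.+ 1)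

    toℕ?-lower₂ : ∀ i j → toℕ? (ℤ/2 (lower₂ i j)) ≡ diagonalIndex i j
    toℕ?-lower₂ i j = trans (toℕ?-ℤ/2 (lower₂ i j)) (trans (cong halfℤ? (ℤ.m-n≡m⊖n i j)) (halfℤ?-⊖ i j))

    lower₃-diagonal : ∀ j k → lower₃ (j ℕ.+ (k ℕ.+ k)) j ≡ (N ℕ.+ N) ⊖ ((j ℕ.+ k) ℕ.+ (j ℕ.+ k))
    lower₃-diagonal j k = trans
      (solve 3 (λ n j k → ((con (+ 1) :+ n) :* con (+ 2)) :- (j :+ (k :+ k)) :- j :- con (+ 2) := (n :+ n) :- ((j :+ k) :+ (j :+ k)))
         refl (+ N) (+ j) (+ k))
      (ℤ.m-n≡m⊖n (N ℕ.+ N) ((j ℕ.+ k) ℕ.+ (j ℕ.+ k)))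
      where open ℤ-Solver.+-*-Solver

    termA≡diagonalTerm : ∀ i j → termA N i j ≡ diagonalTerm c N i j
    termA≡diagonalTerm i j with diagonalIndex i j in d
    ... | nothing = trans (cong (λ m → m * a ^ℚ j * c ^ℚ ((i ∸ j) ℕ./ 2))
                            (multinomial-nothing₂ N (ℕ→ℚ j) (ℤ/2 (lower₂ i j)) (ℤ/2 (lower₃ i j)) (trans (toℕ?-lower₂ i j) d)))
                          (0*x*y≡0 (a ^ℚ j) (c ^ℚ ((i ∸ j) ℕ./ 2)))
    ... | just k = trans (cong₂ (λ m e → m * a ^ℚ j * c ^ℚ e) multinomial≡trinomial exponent)
                         (cong (λ x → ℕ→ℚ (trinomial N j k) * x ^ℚ j * c ^ℚ k) a≡1+c)
      where
      i≡ : i ≡ j ℕ.+ (k ℕ.+ k)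
      i≡ = diagonalIndex-just i j d
      exponent : (i ∸ j) ℕ./ 2 ≡ k
      exponent = trans (cong (λ x → (x ∸ j) ℕ./ 2) i≡) (trans (cong (ℕ._/ 2) (ℕ.m+n∸m≡n j (k ℕ.+ k))) (double/2 k))
      toℕ?-lower₃ : toℕ? (ℤ/2 (lower₃ i j)) ≡ diagonalIndex (N ℕ.+ N) ((j ℕ.+ k) ℕ.+ (j ℕ.+ k))
      toℕ?-lower₃ = trans (toℕ?-ℤ/2 (lower₃ i j))
        (trans (cong halfℤ? (trans (cong (λ x → lower₃ x j) i≡) (lower₃-diagonal j k)))
               (halfℤ?-⊖ (N ℕ.+ N) ((j ℕ.+ k) ℕ.+ (j ℕ.+ k))))
      factorials : ℕ
      factorials = (j !) ℕ.* (k !) ℕ.* ((N ∸ (j ℕ.+ k)) !)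
      multinomial≡trinomial : multinomial N (ℕ→ℚ j) (ℤ/2 (lower₂ i j)) (ℤ/2 (lower₃ i j)) ≡ ℕ→ℚ (trinomial N j k)
      multinomial≡trinomial with j ℕ.+ k ℕ.≤? N
      ... | yes j+k≤N = trans (multinomial-just N (ℕ→ℚ j) (ℤ/2 (lower₂ i j)) (ℤ/2 (lower₃ i j)) (toℕ?-ℕ j)
                                (trans (toℕ?-lower₂ i j) d) (trans toℕ?-lower₃ (diagonalIndex-double-≤ j+k≤N))
                                (ℕ.m+[n∸m]≡n j+k≤N))
                          (trans (cong (λ m → ℕ→ℚ m ÷ℚ ℕ→ℚ factorials) (sym (trinomial*factorials {N} {j} {k} j+k≤N)))
                                 (ℕ→ℚ-*÷ℚ (trinomial N j k) factorials
                                   (ℕ.m<n⇒n≢0 (ℕ.*-mono-≤ (ℕ.*-mono-≤ (ℕ.1≤n! j) (ℕ.1≤n! k)) (ℕ.1≤n! (N ∸ (j ℕ.+ k)))))))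
      ... | no j+k≰N = trans (multinomial-nothing₃ N (ℕ→ℚ j) (ℤ/2 (lower₂ i j)) (ℤ/2 (lower₃ i j))
                               (trans toℕ?-lower₃ (diagonalIndex-double-> (ℕ.≰⇒> j+k≰N))))
                             (sym (cong ℕ→ℚ (trinomial-vanish {N} {j} {k} (ℕ.≰⇒> j+k≰N))))

    module _ where
      open ℤ-Solver.+-*-Solver

      lower₂-shift : ∀ i j → + suc i ℤ.- + j ℤ.- + 1 ≡ lower₂ i j
      lower₂-shift i j = solve 2 (λ i j → (con (+ 1) :+ i) :- j :- con (+ 1) := i :- j) refl (+ i) (+ j)

      lower₃-shift : ∀ i j → + (suc N ℕ.* 2) ℤ.- + suc i ℤ.- + j ℤ.- + 1 ≡ lower₃ i j
      lower₃-shift i j = solve 3 (λ n i j → n :- (con (+ 1) :+ i) :- j :- con (+ 1) := n :- i :- j :- con (+ 2))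
        refl (+ (suc N ℕ.* 2)) (+ i) (+ j)

      lower₂-negative : ∀ j → + 0 ℤ.- + j ℤ.- + 1 ≡ -[1+ j ]
      lower₂-negative j = solve 1 (λ j → con (+ 0) :- j :- con (+ 1) := :- (con (+ 1) :+ j)) refl (+ j)

    termB≡xTimes-termA : ∀ i j → termB N i j ≡ c * xTimes (λ i′ → termA N i′ j) i
    termB≡xTimes-termA zero j =
      trans (cong (λ m → m * a ^ℚ j * c ^ℚ (((0 ∸ j ∸ 1) ℕ./ 2) ℕ.+ 1))
              (multinomial-nothing₂ N (ℕ→ℚ j) (ℤ/2 (+ 0 ℤ.- + j ℤ.- + 1)) (ℤ/2 (+ (suc N ℕ.* 2) ℤ.- + 0 ℤ.- + j ℤ.- + 1))
                (trans (toℕ?-ℤ/2 (+ 0 ℤ.- + j ℤ.- + 1)) (cong halfℤ? (lower₂-negative j)))))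
            (trans (0*x*y≡0 (a ^ℚ j) (c ^ℚ (((0 ∸ j ∸ 1) ℕ./ 2) ℕ.+ 1))) (sym (ℚ.*-zeroʳ c)))
    termB≡xTimes-termA (suc i) j = begin
      termB N (suc i) j
        ≡⟨ cong₂ (λ m e → m * a ^ℚ j * c ^ℚ e)
                 (cong₂ (λ u v → multinomial N (ℕ→ℚ j) (ℤ/2 u) (ℤ/2 v)) (lower₂-shift i j) (lower₃-shift i j)) exponent ⟩
      M * a ^ℚ j * (c * c ^ℚ ((i ∸ j) ℕ./ 2))
        ≡⟨ solve 4 (λ m x c y → m :* x :* (c :* y) := c :* (m :* x :* y)) refl M (a ^ℚ j) c (c ^ℚ ((i ∸ j) ℕ./ 2)) ⟩
      c * termA N i j ∎
      where
      open ≡-Reasoning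
      open +-*-Solver
      M : ℚ
      M = multinomial N (ℕ→ℚ j) (ℤ/2 (lower₂ i j)) (ℤ/2 (lower₃ i j))
      exponent : ((suc i ∸ j ∸ 1) ℕ./ 2) ℕ.+ 1 ≡ suc ((i ∸ j) ℕ./ 2)
      exponent = trans (ℕ.+-comm _ 1)
        (cong (λ x → suc (x ℕ./ 2)) (trans (ℕ.∸-+-assoc (suc i) j 1) (cong (suc i ∸_) (ℕ.+-comm j 1))))

    statement-sum : ∀ {i} → i < suc N ℕ.* 2 →
      sumUpTo (suc N ℕ.* 2) (λ j → termA N i j + termB N i j) ≡ powerCoeff c (suc N) N i
    statement-sum {i} i<n = begin
      sumUpTo n (λ j → termA N i j + termB N i j)      ≡⟨ sumUpTo≡Σ< n (λ j → termA N i j + termB N i j) ⟩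
      Σ< (suc n) (λ j → termA N i j + termB N i j)     ≡⟨ Σ<-+ (suc n) (termA N i) (termB N i) ⟩
      Σ< (suc n) (termA N i) + Σ< (suc n) (termB N i)  ≡⟨ cong₂ _+_ (expansion ℕ.≤-refl) Σ-termB ⟩
      P i + c * xTimes P i                         ∎
      where
      open ≡-Reasoning
      n = suc N ℕ.* 2
      P = powerCoeff c N N
      expansion : ∀ {i′} → i′ ≤ i → Σ< (suc n) (termA N i′) ≡ P i′
      expansion {i′} i′≤i = trans (Σ<-cong (suc n) (λ {j} _ → termA≡diagonalTerm i′ j))
        (trinomial-expansion c N (suc n) i′ (s≤s (ℕ.≤-trans i′≤i (ℕ.<⇒≤ i<n))))
      Σ-termB : Σ< (suc n) (termB N i) ≡ c * xTimes P i
      Σ-termB = begin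
        Σ< (suc n) (termB N i)                              ≡⟨ Σ<-cong (suc n) (λ {j} _ → termB≡xTimes-termA i j) ⟩
        Σ< (suc n) (λ j → c * xTimes (λ i′ → termA N i′ j) i) ≡⟨ Σ<-* (suc n) c (λ j → xTimes (λ i′ → termA N i′ j) i) ⟩
        c * Σ< (suc n) (λ j → xTimes (λ i′ → termA N i′ j) i) ≡⟨ cong (c *_) (Σ<-xTimes (suc n) (λ j i′ → termA N i′ j) i) ⟩
        c * xTimes (λ i′ → Σ< (suc n) (termA N i′)) i       ≡⟨ cong (c *_) (xTimes-cong i (λ i′<i → expansion (ℕ.<⇒≤ i′<i))) ⟩
        c * xTimes P i                                    ∎

open HookCharacters using (χ-hook-invClass; dim-hook)
open CoefficientSequences
open MultinomialDecoding
open import Data.Nat.Base using (suc)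
import Data.Nat.Properties as ℕ
import Data.Nat.Solver as ℕ-Solver
open import Data.Nat.Divisibility using (divides)
open import Data.Rational.Base using (_+_; _*_; _-_; -_)
import Data.Rational.Properties as ℚ
open import Data.Rational.Solver using (module +-*-Solver)
open import Relation.Nullary.Decidable using (yes; no)
open import Relation.Binary.PropositionalEquality using (refl; sym; trans; cong; cong₂; subst; module ≡-Reasoning)

÷ℚ≡1÷ℚ* : ∀ x y → x ÷ℚ y ≡ (1ℚ ÷ℚ y) * x
÷ℚ≡1÷ℚ* x y with y ℚ.≟ 0ℚ
... | yes _   = sym (ℚ.*-zeroˡ x)
... | no  y≢0 = trans (ℚ.*-comm x (ℚ.1/ y)) (cong (_* x) (sym (ℚ.*-identityˡ (ℚ.1/ y))))
  where instance _ = ℚ.≢-nonZero y≢0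

invClass-exponent : ∀ N {s} → s ≤ suc N → s ℕ.+ (suc N ℕ.* 2 ∸ 2 ℕ.* s) ∸ 1 ≡ suc N ∸ s ℕ.+ N
invClass-exponent N {s} s≤ = begin
  s ℕ.+ (suc N ℕ.* 2 ∸ 2 ℕ.* s) ∸ 1 ≡⟨ cong (λ x → s ℕ.+ x ∸ 1) n∸2s ⟩
  s ℕ.+ (t ℕ.+ t) ∸ 1               ≡⟨ cong (_∸ 1) (trans (sym (ℕ.+-assoc s t t)) (cong (ℕ._+ t) s+t)) ⟩
  N ℕ.+ t                           ≡⟨ ℕ.+-comm N t ⟩
  t ℕ.+ N                           ∎
  where
  open ≡-Reasoning
  t = suc N ∸ s
  s+t : s ℕ.+ t ≡ suc N
  s+t = ℕ.m+[n∸m]≡n s≤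
  n∸2s : suc N ℕ.* 2 ∸ 2 ℕ.* s ≡ t ℕ.+ t
  n∸2s = trans (cong (λ m → m ℕ.* 2 ∸ 2 ℕ.* s) (sym s+t))
    (trans (cong (_∸ 2 ℕ.* s) (solve 2 (λ s t → (s :+ t) :* con 2 := con 2 :* s :+ (t :+ t)) refl s t))
           (ℕ.m+n∸m≡n (2 ℕ.* s) (t ℕ.+ t)))
    where open ℕ-Solver.+-*-Solver

2p≡1+[2p-1] : ∀ p → ℕ→ℚ 2 * p ≡ 1ℚ + (ℕ→ℚ 2 * p - 1ℚ)
2p≡1+[2p-1] = solve 1 (λ p → con (ℕ→ℚ 2) :* p := con 1ℚ :+ (con (ℕ→ℚ 2) :* p :- con 1ℚ)) refl
  where open +-*-Solver

p+[1-p][-1]≡2p-1 : ∀ p → p + (1ℚ - p) * - 1ℚ ≡ ℕ→ℚ 2 * p - 1ℚ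
p+[1-p][-1]≡2p-1 = solve 1 (λ p → p :+ (con 1ℚ :- p) :* (:- con 1ℚ) := con (ℕ→ℚ 2) :* p :- con 1ℚ) refl
  where open +-*-Solver

ψ-hook : ∀ N p {i} → i < suc N ℕ.* 2 →
  ψ (suc N ℕ.* 2) (hook (suc N ℕ.* 2) i) p ≡
    (1ℚ ÷ℚ ℕ→ℚ ((suc N ℕ.* 2 ∸ 1) C i)) * powerCoeff (ℕ→ℚ 2 * p - 1ℚ) (suc N) N i
ψ-hook N p {i} i<n = begin
  sumUpTo (n ℕ./ 2) (term (n ℕ./ 2))                  ≡⟨ cong (λ m → sumUpTo m (term m)) (m*2/2≡m (suc N)) ⟩
  sumUpTo (suc N) (term (suc N))                      ≡⟨ sumUpTo≡Σ< (suc N) (term (suc N)) ⟩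
  Σ< (suc (suc N)) (term (suc N))                     ≡⟨ Σ<-cong (suc (suc N)) (λ s<N+2 → term≡ (ℕ.≤-pred s<N+2)) ⟩
  Σ< (suc (suc N)) (λ s → D * (weight (suc N) s * Q s)) ≡⟨ Σ<-* (suc (suc N)) D (λ s → weight (suc N) s * Q s) ⟩
  D * mixture (suc N) N i                             ≡⟨ cong (D *_) (mixture≡powerCoeff (suc N) N i) ⟩
  D * powerCoeff (p + (1ℚ - p) * - 1ℚ) (suc N) N i    ≡⟨ cong (λ c → D * powerCoeff c (suc N) N i) (p+[1-p][-1]≡2p-1 p) ⟩
  D * powerCoeff (ℕ→ℚ 2 * p - 1ℚ) (suc N) N i         ∎
  where
  open ≡-Reasoning
  open Mixing p (- 1ℚ)
  open +-*-Solver
  n = suc N ℕ.* 2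
  D = 1ℚ ÷ℚ ℕ→ℚ ((n ∸ 1) C i)
  Q : ℕ → ℚ
  Q s = powerCoeff (- 1ℚ) s (suc N ∸ s ℕ.+ N) i
  term : ℕ → ℕ → ℚ
  term m s = p ^ℚ (m ∸ s) * (1ℚ - p) ^ℚ s * ℕ→ℚ (m C s)
           * (ℤ→ℚ (χ (hook n i) (invClass n s)) ÷ℚ ℤ→ℚ (dim n (hook n i)))
  term≡ : ∀ {s} → s ≤ suc N → term (suc N) s ≡ D * (weight (suc N) s * Q s)
  term≡ {s} s≤ = begin
    weight (suc N) s * (ℤ→ℚ (χ (hook n i) (invClass n s)) ÷ℚ ℤ→ℚ (dim n (hook n i)))
      ≡⟨ cong (weight (suc N) s *_) (trans (cong₂ _÷ℚ_ character dimension) (÷ℚ≡1÷ℚ* (Q s) (ℕ→ℚ ((n ∸ 1) C i)))) ⟩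
    weight (suc N) s * (D * Q s)
      ≡⟨ solve 3 (λ w d q → w :* (d :* q) := d :* (w :* q)) refl (weight (suc N) s) D (Q s) ⟩
    D * (weight (suc N) s * Q s) ∎
    where
    s+s≤n : s ℕ.+ s ≤ n
    s+s≤n = subst (s ℕ.+ s ≤_) (sym (m*2≡m+m (suc N))) (ℕ.+-mono-≤ s≤ s≤)
    character : ℤ→ℚ (χ (hook n i) (invClass n s)) ≡ Q s
    character = trans (cong ℤ→ℚ (χ-hook-invClass {n} {i} {s} i<n s+s≤n))
      (trans (ℤ→ℚ-mixedBinomial s (s ℕ.+ (n ∸ 2 ℕ.* s) ∸ 1) i)
             (cong (λ e → powerCoeff (- 1ℚ) s e i) (invClass-exponent N s≤)))
    dimension : ℤ→ℚ (dim n (hook n i)) ≡ ℕ→ℚ ((n ∸ 1) C i)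
    dimension = cong ℤ→ℚ (dim-hook i<n)

mainTheorem14 : (n : ℕ) → 2 ≤ n → 2 ∣ n → (p : ℚ) → 0ℚ ℚ.≤ p → p ℚ.≤ 1ℚ → (i : ℕ) → i < n →
    ψ n (hook n i) p ≡
      (1ℚ ÷ℚ ℕ→ℚ ((n ∸ 1) C i)) ℚ.*
      sumUpTo n (λ j →
        multinomial (n ℕ./ 2 ∸ 1) (ℕ→ℚ j)
            (ℤ/2 (+ i ℤ.- + j)) (ℤ/2 (+ n ℤ.- + i ℤ.- + j ℤ.- + 2))
          ℚ.* (((ℕ→ℚ 2) ℚ.* p) ^ℚ j)
          ℚ.* ((((ℕ→ℚ 2) ℚ.* p) ℚ.- 1ℚ) ^ℚ ((i ∸ j) ℕ./ 2))
        ℚ.+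
        multinomial (n ℕ./ 2 ∸ 1) (ℕ→ℚ j)
            (ℤ/2 (+ i ℤ.- + j ℤ.- + 1)) (ℤ/2 (+ n ℤ.- + i ℤ.- + j ℤ.- + 1))
          ℚ.* (((ℕ→ℚ 2) ℚ.* p) ^ℚ j)
          ℚ.* ((((ℕ→ℚ 2) ℚ.* p) ℚ.- 1ℚ) ^ℚ (((i ∸ j ∸ 1) ℕ./ 2) ℕ.+ 1)))
mainTheorem14 .(suc N ℕ.* 2) _ (divides (suc N) refl) p _ _ i i<n =
  subst (λ M → ψ n (hook n i) p ≡ (1ℚ ÷ℚ ℕ→ℚ ((n ∸ 1) C i)) * sumUpTo n (λ j → termA M i j + termB M i j))
        (cong (_∸ 1) (sym (m*2/2≡m (suc N))))
        (trans (ψ-hook N p i<n) (cong ((1ℚ ÷ℚ ℕ→ℚ ((n ∸ 1) C i)) *_) (sym (statement-sum i<n))))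
  where
  n = suc N ℕ.* 2
  open StatementTerms N (ℕ→ℚ 2 * p) (ℕ→ℚ 2 * p - 1ℚ) (2p≡1+[2p-1] p)
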